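{- Let $d\ge 3$, $h\ge 1$. The order $g(d,h)$ of the sandpile group $G(d,h)$ equals $$d(d-1)^h\,[\theta(d,h+1)]^{d-1}\prod_{n=1}^{h-1}[\theta(d,h+1-n)]^{(d-2)d(d-1)^{n-1}},$$ where $\theta(d,n)=\frac{(d-1)^n-1}{d-2}$.
   Context: Let $\mathcal{T}(d,h)$ be the ball of radius $h$ about a root vertex $0$ in the infinite $d$-regular tree (root has $d$ children, vertices at depth $1,\dots,h-1$ have $d-1$ children, depth-$h$ vertices are leaves). Let $V$ be its vertex set, $p(i)$ the parent of $i\neq 0$, $C_i$ the children of $i$, $\{\mathbf{x}_i\}$ the standard basis of $\mathbb{Z}^V$, and $\delta_i = d\mathbf{x}_i - \mathbf{x}_{p(i)} - \sum_{j\in C_i}\mathbf{x}_j$ (omit $\mathbf{x}_{p(i)}$ for $i=0$; empty sum for leaves). The sandpile group is $G(d,h)=\mathbb{Z}^V/\sum_{i\in V}\mathbb{Z}\delta_i$. -}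

module Defs where

open import Data.Nat using (ℕ; zero; suc; _≤_; _<_; _∸_; _^_; _≟_; _<?_; z≤n; s≤s)
import Data.Nat as N
open import Data.Nat.Properties using (<-trans; n<1+n)
open import Data.Nat.DivMod using (_/_)
open import Data.Fin using (Fin; toℕ)
import Data.Fin as F
open import Data.Fin.Properties using (toℕ<n)
open import Data.Vec using (Vec; []; _∷_)
import Data.Vec.Properties as VP
open import Data.List using (List; []; _∷_; map; concatMap; foldr; allFin; upTo)
open import Data.Nat.ListAction using (product)
open import Data.Integer using (ℤ; +_; _+_; _-_; _*_)
open import Data.Product using (Σ; ∃; _×_; _,_)
open import Relation.Nullary using (Dec; yes; no; does)
open import Relation.Binary.PropositionalEquality using (_≡_; refl; cong)
open import Data.Bool using (if_then_else_)

-- A non-root vertex at depth k+1 (k < h) is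
-- `node k _ a v` : a ∈ Fin d is the child of the root on its path,
-- v ∈ Vec (Fin (d-1)) k lists the remaining child choices, MOST RECENT FIRST
-- (so the parent is obtained by dropping the head of v).
-- The bound k < h is an irrelevant argument, so it does not distinguish vertices.
data V (d h : ℕ) : Set where
  root : V d h
  node : (k : ℕ) → .(k < h) → Fin d → Vec (Fin (d ∸ 1)) k → V d h

_≟V_ : ∀ {d h} (i j : V d h) → Dec (i ≡ j)
root ≟V root = yes refl
root ≟V node _ _ _ _ = no (λ ())
node _ _ _ _ ≟V root = no (λ ())
node k p a v ≟V node k′ p′ a′ v′ with k ≟ k′
... | no k≢ = no (λ { refl → k≢ refl })
... | yes refl with a F.≟ a′ | VP.≡-dec F._≟_ v v′
...   | yes refl | yes refl = yes refl
...   | no a≢ | _ = no (λ { refl → a≢ refl })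
...   | yes _ | no v≢ = no (λ { refl → v≢ refl })

parentN : ∀ {d h} (k : ℕ) → .(k < h) → Fin d → Vec (Fin (d ∸ 1)) k → V d h
parentN zero p a [] = root
parentN (suc k) p a (c ∷ v) = node k (<-trans (n<1+n k) p) a v

children : ∀ {d h} → V d h → List (V d h)
children {d} {h} root with 0 <? h
... | yes q = map (λ a → node 0 q a []) (allFin d)
... | no _ = []
children {d} {h} (node k p a v) with suc k <? h
... | yes q = map (λ c → node (suc k) q a (c ∷ v)) (allFin (d ∸ 1))
... | no _ = []

allVec : (m k : ℕ) → List (Vec (Fin m) k)
allVec m zero = [] ∷ []
allVec m (suc k) = concatMap (λ c → map (c ∷_) (allVec m k)) (allFin m)

allV : (d h : ℕ) → List (V d h)
allV d h = root ∷ concatMap (λ k → concatMap (λ a → map (node (toℕ k) (toℕ<n k) a) (allVec (d ∸ 1) (toℕ k))) (allFin d)) (allFin h)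

sumℤ : List ℤ → ℤ
sumℤ = foldr _+_ (+ 0)

basis : ∀ {d h} → V d h → V d h → ℤ
basis i j = if does (i ≟V j) then + 1 else + 0

δ : ∀ {d h} → V d h → V d h → ℤ
δ {d} root j = (+ d) * basis root j - sumℤ (map (λ c → basis c j) (children root))
δ {d} (node k p a v) j =
  (+ d) * basis (node k p a v) j - basis (parentN k p a v) j
    - sumℤ (map (λ c → basis c j) (children (node k p a v)))

InL : (d h : ℕ) → (V d h → ℤ) → Set
InL d h x = ∃ λ (c : V d h → ℤ) → ∀ j → x j ≡ sumℤ (map (λ i → c i * δ i j) (allV d h))

-- congruence modulo the subgroup: equality in G(d,h)
-- G(d,h) = Z^V / Σ Z δ_i has order N: there are N representatives hitting
-- every class exactly once.
HasOrder : (d h N : ℕ) → Set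
HasOrder d h N = Σ (Fin N → V d h → ℤ) λ r →
  (∀ (x : V d h → ℤ) → ∃ λ k → InL d h (λ j → x j - r k j)) ×
  (∀ k l → InL d h (λ j → r k j - r l j) → k ≡ l)

-- θ(d,n) = ((d-1)^n - 1)/(d-2)  (exact division; junk value 0 when d ≤ 2, never used)
θ : ℕ → ℕ → ℕ
θ d n with d ∸ 2
... | zero = 0
... | suc m = ((d ∸ 1) ^ n ∸ 1) / suc m

gFormula : ℕ → ℕ → ℕ
gFormula d h =
  d N.* (d ∸ 1) ^ h N.* θ d (suc h) ^ (d ∸ 1)
    N.* product (map (λ n → θ d (suc h ∸ n) ^ ((d ∸ 2) N.* d N.* (d ∸ 1) ^ (n ∸ 1)))
                     (map suc (upTo (h ∸ 1))))

module Submission where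

-- The sandpile group is ℤ^V modulo the image of the (symmetric) Laplacian Δ. Filter ℤ^V by the
-- subgroups of vectors invariant under more and more transpositions of sibling subtrees, deepest
-- level first and then at the root. Δ commutes with these symmetries and is injective (maximum
-- principle), so a vector Δc is invariant exactly when c is; hence every step of the filtration
-- splits off a quotient. Taking differences of values along two sibling branches identifies that
-- quotient with copies of ℤ^{t+1} modulo a tridiagonal "path" matrix, a cyclic group whose order is
-- the determinant θ(d, t+2), computed from the repunit recurrence. The fully symmetric (radial)
-- vectors form one last path whose determinant is d(d-1)^h, and multiplying all orders gives the
-- formula.

open import Data.Nat as ℕ using (ℕ; zero; suc; z≤n; s≤s; _^_; _≤_)
import Data.Nat.Properties as ℕP
import Data.Nat.Tactic.RingSolver as NS
open import Data.Nat.DivMod using (_/_; m*n/n≡m)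
open import Data.Nat.ListAction using (product)
open import Data.Nat.ListAction.Properties using (product-++)
open import Data.Integer as ℤ using (ℤ; +_; _+_; _-_; _*_; -_; ∣_∣; _⊖_; -≤+; +≤+)
import Data.Integer.Properties as ℤP
open import Data.Integer.DivMod using (_%ℕ_; _/ℕ_; a≡a%ℕn+[a/ℕn]*n; n%ℕd<d)
open import Data.Integer.Tactic.RingSolver using (solve-∀)
open import Data.Fin as F using (Fin; zero; suc; toℕ; fromℕ<; remQuot; combine)
open import Data.Fin.Properties using (toℕ<n; toℕ-fromℕ<; toℕ-injective; suc-injective; remQuot-combine; combine-remQuot)
open import Data.Vec using (Vec; []; _∷_; _++_; replicate)
open import Data.List as List using (List; []; _∷_; map; concatMap; allFin; upTo; _∷ʳ_)
import Data.List.Properties as LP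
open import Data.List.Relation.Unary.Any as Any using (here; there)
open import Data.List.Membership.Propositional using (_∈_)
open import Data.List.Membership.Propositional.Properties using (∈-map⁺; ∈-concatMap⁺; ∈-allFin)
open import Data.Product using (Σ; ∃; _×_; _,_; proj₁; proj₂; uncurry)
open import Data.Sum using (inj₁; inj₂)
open import Data.Empty using (⊥-elim)
open import Relation.Nullary using (Dec; yes; no)
open import Relation.Nullary.Decidable using (recompute)
open import Relation.Binary.PropositionalEquality
open import Function using (_∘_; id)
open import Defs

cong₃ : ∀ {A B C D : Set} (f : A → B → C → D) {x x' y y' z z'} → x ≡ x' → y ≡ y' → z ≡ z' → f x y z ≡ f x' y' z'
cong₃ f refl refl refl = refl

_≈_ : {X : Set} (x y : X → ℤ) → Set
x ≈ y = ∀ j → x j ≡ y j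
infix 4 _≈_

_-ᵥ_ : {X : Set} (x y : X → ℤ) → X → ℤ
(x -ᵥ y) j = x j - y j
_+ᵥ_ : {X : Set} (x y : X → ℤ) → X → ℤ
(x +ᵥ y) j = x j + y j
infixl 6 _-ᵥ_ _+ᵥ_

𝟘 : {X : Set} → X → ℤ
𝟘 _ = + 0

record IsSubgroup {X : Set} (P : (X → ℤ) → Set) : Set where
  field
    ∈-resp : ∀ {x y} → x ≈ y → P x → P y
    𝟘∈ : P 𝟘
    +∈ : ∀ {x y} → P x → P y → P (x +ᵥ y)
    neg∈ : ∀ {x} → P x → P (λ j → - x j)
  -∈ : ∀ {x y} → P x → P y → P (x -ᵥ y)
  -∈ px py = +∈ px (neg∈ py)

×-subgroup : {X : Set} {P Q : (X → ℤ) → Set} → IsSubgroup P → IsSubgroup Q → IsSubgroup (λ x → P x × Q x)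
×-subgroup sP sQ = record
  { ∈-resp = λ eq (p , q) → IsSubgroup.∈-resp sP eq p , IsSubgroup.∈-resp sQ eq q
  ; 𝟘∈ = IsSubgroup.𝟘∈ sP , IsSubgroup.𝟘∈ sQ
  ; +∈ = λ (p , q) (p' , q') → IsSubgroup.+∈ sP p p' , IsSubgroup.+∈ sQ q q'
  ; neg∈ = λ (p , q) → IsSubgroup.neg∈ sP p , IsSubgroup.neg∈ sQ q }

Π-subgroup : {X I : Set} {P : I → (X → ℤ) → Set} → (∀ i → IsSubgroup (P i)) → IsSubgroup (λ x → ∀ i → P i x)
Π-subgroup sP = record
  { ∈-resp = λ eq p i → IsSubgroup.∈-resp (sP i) eq (p i)
  ; 𝟘∈ = λ i → IsSubgroup.𝟘∈ (sP i)
  ; +∈ = λ p q i → IsSubgroup.+∈ (sP i) (p i) (q i)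
  ; neg∈ = λ p i → IsSubgroup.neg∈ (sP i) (p i) }

QuotientOrder : {X : Set} (A L : (X → ℤ) → Set) (N : ℕ) → Set
QuotientOrder {X} A L N = Σ (Fin N → X → ℤ) λ r →
  (∀ k → A (r k)) ×
  (∀ x → A x → ∃ λ k → L (x -ᵥ r k)) ×
  (∀ k l → L (r k -ᵥ r l) → k ≡ l)

QuotientOrder-⇔ : {X : Set} {A A' L L' : (X → ℤ) → Set} {N : ℕ} →
  (∀ x → A x → A' x) → (∀ x → A' x → A x) →
  (∀ x → L x → L' x) → (∀ x → L' x → L x) →
  QuotientOrder A L N → QuotientOrder A' L' N
QuotientOrder-⇔ a→ a← l→ l← (r , rA , cov , uq) =
  r , (λ k → a→ _ (rA k)) ,
  (λ x ax → let (k , lk) = cov x (a← x ax) in k , l→ _ lk) ,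
  (λ k l p → uq k l (l← _ p))

-- [A : L] = [B : LB] · [A' : L'] when π maps A onto B with kernel A' and L onto LB.
module Extension {X Y : Set}
  (A L A' L' : (X → ℤ) → Set) (B LB : (Y → ℤ) → Set)
  (A-subgroup : IsSubgroup A) (L-subgroup : IsSubgroup L) (A'-subgroup : IsSubgroup A')
  (B-subgroup : IsSubgroup B) (LB-subgroup : IsSubgroup LB)
  (π : (X → ℤ) → (Y → ℤ)) (σ : (Y → ℤ) → (X → ℤ))
  (π-+ : ∀ x y → π (x +ᵥ y) ≈ π x +ᵥ π y)
  (π-- : ∀ x y → π (x -ᵥ y) ≈ π x -ᵥ π y)
  (π∈B : ∀ x → A x → B (π x))
  (σ∈A : ∀ y → B y → A (σ y))
  (πσ : ∀ y → B y → π (σ y) ≈ y)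
  (π∈LB : ∀ x → A x → L x → LB (π x))
  (lift : ∀ y → B y → LB y → ∃ λ ℓ → A ℓ × L ℓ × π ℓ ≈ y)
  (A'⊆A : ∀ x → A' x → A x)
  (π-A' : ∀ x → A' x → π x ≈ 𝟘)
  (ker⊆A' : ∀ x → A x → π x ≈ 𝟘 → A' x)
  (L∩A'⊆L' : ∀ x → A' x → L x → L' x)
  (L'⊆L : ∀ x → L' x → L x)
  where
  private
    module SA = IsSubgroup A-subgroup
    module SL = IsSubgroup L-subgroup
    module SA' = IsSubgroup A'-subgroup
    module SB = IsSubgroup B-subgroup
    module SLB = IsSubgroup LB-subgroup

  extension : ∀ {N₁ N₂} → QuotientOrder B LB N₁ → QuotientOrder A' L' N₂ → QuotientOrder A L (N₁ ℕ.* N₂)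
  extension {N₁} {N₂} (r₁ , r₁∈B , cover₁ , unique₁) (r₂ , r₂∈A' , cover₂ , unique₂) =
    rep ∘ remQuot {N₁} N₂ , rep∈A ∘ remQuot {N₁} N₂ , cover , unique
    where
    rep : Fin N₁ × Fin N₂ → X → ℤ
    rep (k₁ , k₂) = σ (r₁ k₁) +ᵥ r₂ k₂

    rep∈A : ∀ k → A (rep k)
    rep∈A (k₁ , k₂) = SA.+∈ (σ∈A _ (r₁∈B k₁)) (A'⊆A _ (r₂∈A' k₂))

    cover : ∀ x → A x → ∃ λ k → L (x -ᵥ rep (remQuot {N₁} N₂ k))
    cover x x∈A = combine {N₁} {N₂} k₁ k₂ , subst (λ k → L (x -ᵥ rep k)) (sym (remQuot-combine {N₁} {N₂} k₁ k₂)) x-rep∈L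
      where
      k₁ = proj₁ (cover₁ (π x) (π∈B x x∈A))
      ℓ-lift = lift _ (SB.-∈ (π∈B x x∈A) (r₁∈B k₁)) (proj₂ (cover₁ (π x) (π∈B x x∈A)))
      ℓ = proj₁ ℓ-lift
      ℓ∈A = proj₁ (proj₂ ℓ-lift)
      ℓ∈L = proj₁ (proj₂ (proj₂ ℓ-lift))
      πℓ = proj₂ (proj₂ (proj₂ ℓ-lift))
      z : X → ℤ
      z = x -ᵥ σ (r₁ k₁) -ᵥ ℓ
      πz≈𝟘 : π z ≈ 𝟘
      πz≈𝟘 j = begin
        π z j                                         ≡⟨ π-- (x -ᵥ σ (r₁ k₁)) ℓ j ⟩
        π (x -ᵥ σ (r₁ k₁)) j - π ℓ j                  ≡⟨ cong₂ _-_ (π-- x (σ (r₁ k₁)) j) (πℓ j) ⟩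
        (π x j - π (σ (r₁ k₁)) j) - (π x j - r₁ k₁ j) ≡⟨ cong (λ u → (π x j - u) - (π x j - r₁ k₁ j)) (πσ _ (r₁∈B k₁) j) ⟩
        (π x j - r₁ k₁ j) - (π x j - r₁ k₁ j)         ≡⟨ ℤP.+-inverseʳ (π x j - r₁ k₁ j) ⟩
        + 0                                           ∎
        where open ≡-Reasoning
      z∈A' = ker⊆A' z (SA.-∈ (SA.-∈ x∈A (σ∈A _ (r₁∈B k₁))) ℓ∈A) πz≈𝟘
      k₂ = proj₁ (cover₂ z z∈A')
      x-rep∈L : L (x -ᵥ rep (k₁ , k₂))
      x-rep∈L = SL.∈-resp (λ j → regroup (x j) (σ (r₁ k₁) j) (ℓ j) (r₂ k₂ j)) (SL.+∈ (L'⊆L _ (proj₂ (cover₂ z z∈A'))) ℓ∈L)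
        where
        regroup : ∀ x s l r → (x - s - l - r) + l ≡ x - (s + r)
        regroup = solve-∀

    unique : ∀ k l → L (rep (remQuot {N₁} N₂ k) -ᵥ rep (remQuot {N₁} N₂ l)) → k ≡ l
    unique k l p = begin
      k                                ≡⟨ combine-remQuot {N₁} N₂ k ⟨
      uncurry (combine {N₁} {N₂}) (remQuot {N₁} N₂ k)   ≡⟨ unique-pair (remQuot {N₁} N₂ k) (remQuot {N₁} N₂ l) p ⟩
      uncurry (combine {N₁} {N₂}) (remQuot {N₁} N₂ l)   ≡⟨ combine-remQuot {N₁} N₂ l ⟩
      l                                ∎
      where
      open ≡-Reasoning
      unique-pair : ∀ a b → L (rep a -ᵥ rep b) → uncurry (combine {N₁} {N₂}) a ≡ uncurry (combine {N₁} {N₂}) b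
      unique-pair (a₁ , a₂) (b₁ , b₂) q with unique₁ a₁ b₁ (SLB.∈-resp π-rep (π∈LB _ (SA.-∈ (rep∈A (a₁ , a₂)) (rep∈A (b₁ , b₂))) q))
        where
        π-rep : π (rep (a₁ , a₂) -ᵥ rep (b₁ , b₂)) ≈ r₁ a₁ -ᵥ r₁ b₁
        π-rep j = begin
          π (rep (a₁ , a₂) -ᵥ rep (b₁ , b₂)) j                           ≡⟨ π-- _ _ j ⟩
          π (rep (a₁ , a₂)) j - π (rep (b₁ , b₂)) j                      ≡⟨ cong₂ _-_ (π-+ _ _ j) (π-+ _ _ j) ⟩
          (π (σ (r₁ a₁)) j + π (r₂ a₂) j) - (π (σ (r₁ b₁)) j + π (r₂ b₂) j)
            ≡⟨ cong₂ _-_ (cong₂ _+_ (πσ _ (r₁∈B a₁) j) (π-A' _ (r₂∈A' a₂) j)) (cong₂ _+_ (πσ _ (r₁∈B b₁) j) (π-A' _ (r₂∈A' b₂) j)) ⟩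
          (r₁ a₁ j + + 0) - (r₁ b₁ j + + 0)                              ≡⟨ cong₂ _-_ (ℤP.+-identityʳ (r₁ a₁ j)) (ℤP.+-identityʳ (r₁ b₁ j)) ⟩
          r₁ a₁ j - r₁ b₁ j                                              ∎
      ... | refl = cong (combine {N₁} {N₂} a₁)
          (unique₂ a₂ b₂ (L∩A'⊆L' _ (SA'.-∈ (r₂∈A' a₂) (r₂∈A' b₂)) (SL.∈-resp (λ j → cancel (σ (r₁ a₁) j) (r₂ a₂ j) (r₂ b₂ j)) q)))
        where
        cancel : ∀ s a b → (s + a) - (s + b) ≡ a - b
        cancel = solve-∀

∣m⊖n∣< : ∀ {N} k l → k ℕ.< N → l ℕ.< N → ∣ k ⊖ l ∣ ℕ.< N
∣m⊖n∣< {N} k l k< l< with ℕP.≤-total k l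
... | inj₁ k≤l = ℕP.≤-<-trans (subst (ℕ._≤ l) (sym (ℤP.∣⊖∣-≤ k≤l)) (ℕP.m∸n≤m l k)) l<
... | inj₂ l≤k = ℕP.≤-<-trans (subst (ℕ._≤ k) (sym (trans (ℤP.∣m⊖n∣≡∣n⊖m∣ k l) (ℤP.∣⊖∣-≤ l≤k))) (ℕP.m∸n≤m k l)) k<

≡-if-congruent-below : ∀ N k l (z : ℤ) → k ℕ.< N → l ℕ.< N → + k - + l ≡ + N * z → k ≡ l
≡-if-congruent-below N k l z k< l< eq = ℤP.+-injective (begin
    + k ≡⟨ hk (+ k) (+ l) ⟩
    (+ k - + l) + + l ≡⟨ cong (_+ + l) eq ⟩
    + N * z + + l ≡⟨ cong (λ u → + N * u + + l) z0 ⟩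
    + N * + 0 + + l ≡⟨ cong (_+ + l) (ℤP.*-zeroʳ (+ N)) ⟩
    + l ∎)
  where
  open ≡-Reasoning
  hk : ∀ a b → a ≡ (a - b) + b
  hk = solve-∀
  absEq : ∣ k ⊖ l ∣ ≡ N ℕ.* ∣ z ∣
  absEq = trans (cong ∣_∣ (sym (ℤP.[+m]-[+n]≡m⊖n k l))) (trans (cong ∣_∣ eq) (ℤP.∣i*j∣≡∣i∣*∣j∣ (+ N) z))
  z0 : z ≡ + 0
  z0 with ∣ z ∣ ℕ.≟ 0
  ... | yes p = ℤP.∣i∣≡0⇒i≡0 p
  ... | no p = ⊥-elim (ℕP.<⇒≱ (∣m⊖n∣< k l k< l<) (subst (N ℕ.≤_) (sym absEq) (ℕP.m≤m*n N ∣ z ∣ {{ℕ.≢-nonZero p}})))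

-- The bound is irrelevant, so a restricted value never depends on which proof of s ≤ t is supplied.
restrict : (t : ℕ) → ((s : ℕ) → .(s ℕ.≤ t) → ℤ) → ℕ → ℤ
restrict t f s with s ℕ.≤? t
... | yes le = f s le
... | no _ = + 0

module _ {t : ℕ} where

  restrict-≤ : ∀ f s (le : s ℕ.≤ t) → restrict t f s ≡ f s le
  restrict-≤ f s le with s ℕ.≤? t
  ... | yes _ = refl
  ... | no s≰t = ⊥-elim (s≰t le)

  restrict-> : ∀ f s → t ℕ.< s → restrict t f s ≡ + 0
  restrict-> f s t<s with s ℕ.≤? t
  ... | yes s≤t = ⊥-elim (ℕP.<⇒≱ t<s s≤t)
  ... | no _ = refl

  restrict-cong : ∀ {f g} → (∀ s .(le : s ℕ.≤ t) → f s le ≡ g s le) → ∀ s → restrict t f s ≡ restrict t g s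
  restrict-cong eq s with s ℕ.≤? t
  ... | yes le = eq s le
  ... | no _ = refl

  restrict-zip : ∀ (_∙_ : ℤ → ℤ → ℤ) → (+ 0) ∙ (+ 0) ≡ + 0 → ∀ f g s →
    restrict t (λ s le → f s le ∙ g s le) s ≡ restrict t f s ∙ restrict t g s
  restrict-zip _ 0∙0 f g s with s ℕ.≤? t
  ... | yes _ = refl
  ... | no _ = sym 0∙0

difference-of-rows : ∀ D M a₁ a₀ p₁ p₀ n₁ n₀ →
  (D * a₁ - p₁ - M * n₁) - (D * a₀ - p₀ - M * n₀) ≡ D * (a₁ - a₀) - (p₁ - p₀) - M * (n₁ - n₀)
difference-of-rows = solve-∀

module RestrictedDifference {V : Set} {t : ℕ} (u₁ u₀ : (s : ℕ) → .(s ℕ.≤ t) → V) where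

  diff : (V → ℤ) → ℕ → ℤ
  diff x = restrict t (λ s le → x (u₁ s le) - x (u₀ s le))

  diff-resp : ∀ {x y} → x ≈ y → diff x ≈ diff y
  diff-resp eq = restrict-cong (λ s le → cong₂ _-_ (eq (u₁ s le)) (eq (u₀ s le)))

  diff-+ : ∀ x y → diff (x +ᵥ y) ≈ diff x +ᵥ diff y
  diff-+ x y s = trans (restrict-cong (λ s le → interchange (x (u₁ s le)) (y (u₁ s le)) (x (u₀ s le)) (y (u₀ s le))) s)
                       (restrict-zip _+_ refl (λ s le → x (u₁ s le) - x (u₀ s le)) (λ s le → y (u₁ s le) - y (u₀ s le)) s)
    where
    interchange : ∀ a b c d → (a + b) - (c + d) ≡ (a - c) + (b - d)
    interchange = solve-∀

  diff-- : ∀ x y → diff (x -ᵥ y) ≈ diff x -ᵥ diff y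
  diff-- x y s = trans (restrict-cong (λ s le → interchange (x (u₁ s le)) (y (u₁ s le)) (x (u₀ s le)) (y (u₀ s le))) s)
                       (restrict-zip _-_ refl (λ s le → x (u₁ s le) - x (u₀ s le)) (λ s le → y (u₁ s le) - y (u₀ s le)) s)
    where
    interchange : ∀ a b c d → (a - b) - (c - d) ≡ (a - c) - (b - d)
    interchange = solve-∀

-- ℤ^{t+1} modulo the tridiagonal matrix with diagonal dz, subdiagonal -1 and superdiagonal -mz
-- (-w in the first row); vectors are sequences supported on [0, t]. The quotient is cyclic of order
-- pathDet, generated by e₀.
module PathLattice (dz mz w : ℤ) (t N : ℕ) {{nzN : ℕ.NonZero N}} where

  Supported : (ℕ → ℤ) → Set
  Supported y = ∀ s → t ℕ.< s → y s ≡ + 0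

  pre : (ℕ → ℤ) → ℕ → ℤ
  pre z zero = + 0
  pre z (suc s) = z s

  wt : ℕ → ℤ
  wt zero = w
  wt (suc _) = mz

  row : (ℕ → ℤ) → ℕ → ℤ
  row z s = dz * z s - pre z s - wt s * z (suc s)

  PathImage : (ℕ → ℤ) → Set
  PathImage y = ∃ λ z → Supported z × (∀ s → s ℕ.≤ t → y s ≡ row z s)

  minors : ℕ → ℤ × ℤ
  minors zero = (+ 0 , + 1)
  minors (suc j) = (proj₂ (minors j) , dz * proj₂ (minors j) - mz * proj₁ (minors j))

  pathDet : ℤ
  pathDet = dz * proj₂ (minors t) - w * proj₁ (minors t)

  e₀ : ℤ → ℕ → ℤ
  e₀ c zero = c
  e₀ c (suc _) = + 0

  Supported-subgroup : IsSubgroup Supported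
  Supported-subgroup = record
    { ∈-resp = λ {x} {y} eq p s ts → trans (sym (eq s)) (p s ts)
    ; 𝟘∈ = λ s _ → refl
    ; +∈ = λ {x} {y} px py s ts → cong₂ _+_ (px s ts) (py s ts)
    ; neg∈ = λ {x} px s ts → cong -_ (px s ts) }

  private
    hadd : ∀ d' a a' p p' w' b b' → d' * (a + a') - (p + p') - w' * (b + b') ≡ (d' * a - p - w' * b) + (d' * a' - p' - w' * b')
    hadd = solve-∀
    hneg : ∀ d' a p w' b → d' * (- a) - (- p) - w' * (- b) ≡ - (d' * a - p - w' * b)
    hneg = solve-∀
    hsc : ∀ c d' a p w' b → d' * (c * a) - c * p - w' * (c * b) ≡ c * (d' * a - p - w' * b)
    hsc = solve-∀
    hz : ∀ d' w' → d' * + 0 - + 0 - w' * + 0 ≡ + 0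
    hz = solve-∀
    hsc0 : ∀ c d' a w' b → d' * (c * a) - + 0 - w' * (c * b) ≡ c * (d' * a - + 0 - w' * b)
    hsc0 = solve-∀

  row-add : ∀ z z' s → row (z +ᵥ z') s ≡ row z s + row z' s
  row-add z z' zero = trans (cong (λ u → dz * (z 0 + z' 0) - u - w * (z 1 + z' 1)) (sym (ℤP.+-identityʳ (+ 0)))) (hadd dz (z 0) (z' 0) (+ 0) (+ 0) w (z 1) (z' 1))
  row-add z z' (suc s) = hadd dz (z (suc s)) (z' (suc s)) (z s) (z' s) mz (z (suc (suc s))) (z' (suc (suc s)))

  row-neg : ∀ z s → row (λ j → - z j) s ≡ - row z s
  row-neg z zero = hneg dz (z 0) (+ 0) w (z 1)
  row-neg z (suc s) = hneg dz (z (suc s)) (z s) mz (z (suc (suc s)))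

  row-scale : ∀ c z s → row (λ j → c * z j) s ≡ c * row z s
  row-scale c z zero = hsc0 c dz (z 0) w (z 1)
  row-scale c z (suc s) = hsc c dz (z (suc s)) (z s) mz (z (suc (suc s)))

  row-cong : ∀ {z z'} → z ≈ z' → ∀ s → row z s ≡ row z' s
  row-cong eq zero = cong₂ (λ u v → dz * u - + 0 - w * v) (eq 0) (eq 1)
  row-cong eq (suc s) = cong₃ (λ u v x → dz * u - v - mz * x) (eq (suc s)) (eq s) (eq (suc (suc s)))

  wt≡ : w ≡ mz → ∀ s → wt s ≡ mz
  wt≡ eq zero = eq
  wt≡ eq (suc s) = refl

  row-zero : ∀ s → row 𝟘 s ≡ + 0
  row-zero zero = hz dz w
  row-zero (suc s) = hz dz mz

  PathImage-subgroup : IsSubgroup PathImage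
  PathImage-subgroup = record
    { ∈-resp = λ {x} {y} eq (z , sz , rz) → z , sz , (λ s ts → trans (sym (eq s)) (rz s ts))
    ; 𝟘∈ = 𝟘 , (λ s _ → refl) , (λ s _ → sym (row-zero s))
    ; +∈ = λ {x} {y} (z , sz , rz) (z' , sz' , rz') → z +ᵥ z' ,
        (λ s ts → cong₂ _+_ (sz s ts) (sz' s ts)) ,
        (λ s ts → trans (cong₂ _+_ (rz s ts) (rz' s ts)) (sym (row-add z z' s)))
    ; neg∈ = λ {x} (z , sz , rz) → (λ j → - z j) , (λ s ts → cong -_ (sz s ts)) ,
        (λ s ts → trans (cong -_ (rz s ts)) (sym (row-neg z s))) }

  PathImage-scale : ∀ c {y} → PathImage y → PathImage (λ s → c * y s)
  PathImage-scale c (z , sz , rz) = (λ j → c * z j) , (λ s ts → trans (cong (c *_) (sz s ts)) (ℤP.*-zeroʳ c)) ,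
    (λ s ts → trans (cong (c *_) (rz s ts)) (sym (row-scale c z s)))

  -- adj s t is the s-th entry of the first column of the adjugate, so row (adj · t) = pathDet · e₀.
  adj : ℕ → ℕ → ℤ
  adj zero u = proj₂ (minors u)
  adj (suc s) zero = + 0
  adj (suc s) (suc u) = adj s u

  adj-one : ∀ u → proj₁ (minors u) ≡ adj 1 u
  adj-one zero = refl
  adj-one (suc u) = refl

  adj-rec : ∀ s u → suc s ℕ.≤ u → adj s u ≡ dz * adj (suc s) u - mz * adj (suc (suc s)) u
  adj-rec zero (suc u) _ = cong (λ v → dz * proj₂ (minors u) - mz * v) (adj-one u)
  adj-rec (suc s) (suc u) (s≤s le) = adj-rec s u le

  adj-above : ∀ s u → u ℕ.< s → adj s u ≡ + 0
  adj-above (suc s) zero _ = refl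
  adj-above (suc s) (suc u) (s≤s le) = adj-above s u le

  adj-diag : ∀ u → adj u u ≡ + 1
  adj-diag zero = refl
  adj-diag (suc u) = adj-diag u

  N·e₀∈PathImage : pathDet ≡ + N → PathImage (e₀ (+ N))
  N·e₀∈PathImage nv = (λ s → adj s t) , (λ s ts → adj-above s t ts) , rw
    where
    rw : ∀ s → s ℕ.≤ t → e₀ (+ N) s ≡ row (λ s → adj s t) s
    rw zero _ = begin
      + N ≡⟨ sym nv ⟩
      dz * proj₂ (minors t) - w * proj₁ (minors t) ≡⟨ cong (λ v → dz * proj₂ (minors t) - w * v) (adj-one t) ⟩
      dz * adj 0 t - w * adj 1 t ≡⟨ insert-zero (dz * adj 0 t) (w * adj 1 t) ⟩
      row (λ s → adj s t) zero ∎
      where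
      open ≡-Reasoning
      insert-zero : ∀ a b → a - b ≡ a - + 0 - b
      insert-zero = solve-∀
    rw (suc s) le = begin
      + 0 ≡⟨ helper dz mz (adj (suc s) t) (adj (suc (suc s)) t) ⟩
      dz * adj (suc s) t - (dz * adj (suc s) t - mz * adj (suc (suc s)) t) - mz * adj (suc (suc s)) t
        ≡⟨ cong (λ v → dz * adj (suc s) t - v - mz * adj (suc (suc s)) t) (sym (adj-rec s t le)) ⟩
      row (λ s → adj s t) (suc s) ∎
      where
      open ≡-Reasoning
      helper : ∀ dz mz a b → + 0 ≡ dz * a - (dz * a - mz * b) - mz * b
      helper = solve-∀

  indicator : ℕ → ℕ → ℤ
  indicator zero zero = + 1
  indicator zero (suc _) = + 0
  indicator (suc _) zero = + 0
  indicator (suc j) (suc s) = indicator j s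

  indicator-diag : ∀ j → indicator j j ≡ + 1
  indicator-diag zero = refl
  indicator-diag (suc j) = indicator-diag j

  indicator-above : ∀ j s → j ℕ.< s → indicator j s ≡ + 0
  indicator-above zero (suc s) _ = refl
  indicator-above (suc j) (suc s) (s≤s le) = indicator-above j s le

  row-indicator-next : ∀ j → row (indicator j) (suc j) ≡ - + 1
  row-indicator-next j rewrite indicator-above j (suc j) (ℕP.n<1+n j) | indicator-diag j | indicator-above j (suc (suc j)) (ℕP.m<n⇒m<1+n (ℕP.n<1+n j)) = h dz mz
    where
    h : ∀ a b → a * + 0 - + 1 - b * + 0 ≡ - + 1
    h = solve-∀

  row-indicator-far : ∀ j s → suc j ℕ.< s → row (indicator j) s ≡ + 0
  row-indicator-far j (suc s) (s≤s le) rewrite indicator-above j (suc s) (ℕP.m<n⇒m<1+n le) | indicator-above j s le | indicator-above j (suc (suc s)) (ℕP.m<n⇒m<1+n (ℕP.m<n⇒m<1+n le)) = hz dz mz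

  row-indicator∈PathImage : ∀ j → j ℕ.< t → PathImage (row (indicator j))
  row-indicator∈PathImage j jt = indicator j , (λ s ts → indicator-above j s (ℕP.<-trans jt ts)) , (λ s _ → refl)

  reduce-to-e₀ : ∀ j → j ℕ.≤ t → ∀ y → (∀ s → j ℕ.< s → y s ≡ + 0) → ∃ λ c → PathImage (y -ᵥ e₀ c)
  reduce-to-e₀ zero _ y sy = y 0 , IsSubgroup.∈-resp PathImage-subgroup eq (IsSubgroup.𝟘∈ PathImage-subgroup)
    where
    eq : 𝟘 ≈ y -ᵥ e₀ (y 0)
    eq zero = sym (ℤP.+-inverseʳ (y 0))
    eq (suc s) rewrite sy (suc s) (s≤s z≤n) = refl
  reduce-to-e₀ (suc j) le y sy = c , IsSubgroup.∈-resp PathImage-subgroup eq (IsSubgroup.-∈ PathImage-subgroup lc (PathImage-scale (y (suc j)) (row-indicator∈PathImage j le)))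
    where
    y' : ℕ → ℤ
    y' s = y s + y (suc j) * row (indicator j) s
    sy' : ∀ s → j ℕ.< s → y' s ≡ + 0
    sy' s js with ℕP.m≤n⇒m<n∨m≡n js
    ... | inj₂ refl rewrite row-indicator-next j = a-a≡0 (y (suc j))
      where
      a-a≡0 : ∀ a → a + a * - + 1 ≡ + 0
      a-a≡0 = solve-∀
    ... | inj₁ lt rewrite row-indicator-far j s lt | sy s lt = trans (ℤP.+-identityˡ _) (ℤP.*-zeroʳ (y (suc j)))
    IH = reduce-to-e₀ j (ℕP.<⇒≤ le) y' sy'
    c = proj₁ IH
    lc = proj₂ IH
    eq : y' -ᵥ e₀ c -ᵥ (λ s → y (suc j) * row (indicator j) s) ≈ y -ᵥ e₀ c
    eq s = cancel-b (y s) (y (suc j) * row (indicator j) s) (e₀ c s)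
      where
      cancel-b : ∀ a b e → a + b - e - b ≡ a - e
      cancel-b = solve-∀

  reps : Fin N → ℕ → ℤ
  reps k = e₀ (+ toℕ k)

  reps-supp : ∀ k → Supported (reps k)
  reps-supp k (suc s) _ = refl

  cover : pathDet ≡ + N → ∀ y → Supported y → ∃ λ k → PathImage (y -ᵥ reps k)
  cover nv y sy = k , IsSubgroup.∈-resp PathImage-subgroup eq (IsSubgroup.+∈ PathImage-subgroup lc (PathImage-scale q (N·e₀∈PathImage nv)))
    where
    P = reduce-to-e₀ t ℕP.≤-refl y sy
    c = proj₁ P
    lc = proj₂ P
    k : Fin N
    k = fromℕ< (n%ℕd<d c N)
    q = c /ℕ N
    eq : (y -ᵥ e₀ c) +ᵥ (λ s → q * e₀ (+ N) s) ≈ y -ᵥ reps k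
    eq zero = begin
      (y 0 - c) + q * + N ≡⟨ cong (λ v → (y 0 - v) + q * + N) (a≡a%ℕn+[a/ℕn]*n c N) ⟩
      (y 0 - (+ (c %ℕ N) + q * + N)) + q * + N ≡⟨ cancel-e (y 0) (+ (c %ℕ N)) (q * + N) ⟩
      y 0 - + (c %ℕ N) ≡⟨ cong (λ v → y 0 - + v) (sym (toℕ-fromℕ< (n%ℕd<d c N))) ⟩
      y 0 - + toℕ k ∎
      where
      open ≡-Reasoning
      cancel-e : ∀ a b e → (a - (b + e)) + e ≡ a - b
      cancel-e = solve-∀
    eq (suc s) = add-zero (y (suc s)) q
      where
      add-zero : ∀ a q → (a - + 0) + q * + 0 ≡ a - + 0
      add-zero = solve-∀

  unique : pathDet ≡ + N → ∀ k l → PathImage (reps k -ᵥ reps l) → k ≡ l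
  unique nv k l (z , sz , rz) = toℕ-injective (≡-if-congruent-below N (toℕ k) (toℕ l) (z t) (toℕ<n k) (toℕ<n l) top)
    where
    P : ℕ → Set
    P s = z s ≡ adj s t * z t
    rz0 : ∀ s → suc s ℕ.≤ t → + 0 ≡ row z (suc s)
    rz0 s le = rz (suc s) le
    R : ∀ q s → s ℕ.+ q ≡ suc t → P s × P (suc s)
    R zero s eq = subst (λ v → P v × P (suc v)) (sym (trans (sym (ℕP.+-identityʳ s)) eq)) (
      trans (sz (suc t) ℕP.≤-refl) (sym (trans (cong (_* z t) (adj-above (suc t) t ℕP.≤-refl)) (ℤP.*-zeroˡ (z t)))) ,
      trans (sz (suc (suc t)) (ℕP.m<n⇒m<1+n ℕP.≤-refl)) (sym (trans (cong (_* z t) (adj-above (suc (suc t)) t (ℕP.m<n⇒m<1+n ℕP.≤-refl))) (ℤP.*-zeroˡ (z t)))))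
    R (suc q) s eq = Ps , proj₁ IH
      where
      IH = R q (suc s) (trans (sym (ℕP.+-suc s q)) eq)
      s≤t : s ℕ.≤ t
      s≤t = ℕP.≤-pred (subst (s ℕ.<_) eq (ℕP.m<m+n s {suc q} (s≤s z≤n)))
      Ps : P s
      Ps with ℕP.m≤n⇒m<n∨m≡n s≤t
      ... | inj₂ refl = trans (sym (ℤP.*-identityˡ (z s))) (cong (_* z s) (sym (adj-diag s)))
      ... | inj₁ lt = begin
        z s ≡⟨ helper (z s) (z (suc s)) (z (suc (suc s))) (rz0 s lt) ⟩
        dz * z (suc s) - mz * z (suc (suc s)) ≡⟨ cong₂ (λ a b → dz * a - mz * b) (proj₁ IH) (proj₂ IH) ⟩
        dz * (adj (suc s) t * z t) - mz * (adj (suc (suc s)) t * z t) ≡⟨ helper2 dz mz (adj (suc s) t) (adj (suc (suc s)) t) (z t) ⟩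
        (dz * adj (suc s) t - mz * adj (suc (suc s)) t) * z t ≡⟨ cong (_* z t) (sym (adj-rec s t lt)) ⟩
        adj s t * z t ∎
        where
        open ≡-Reasoning
        helper : ∀ a b c → + 0 ≡ dz * b - a - mz * c → a ≡ dz * b - mz * c
        helper a b c h = begin
          a ≡⟨ recover-a dz mz a b c ⟩
          (dz * b - mz * c) - (dz * b - a - mz * c) ≡⟨ cong (λ v → (dz * b - mz * c) - v) (sym h) ⟩
          (dz * b - mz * c) - + 0 ≡⟨ ℤP.+-identityʳ _ ⟩
          dz * b - mz * c ∎
          where
          recover-a : ∀ dz mz a b c → a ≡ (dz * b - mz * c) - (dz * b - a - mz * c)
          recover-a = solve-∀
        helper2 : ∀ dz mz a b c → dz * (a * c) - mz * (b * c) ≡ (dz * a - mz * b) * c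
        helper2 = solve-∀
    R0 = R (suc t) 0 refl
    top : + toℕ k - + toℕ l ≡ + N * z t
    top = begin
      + toℕ k - + toℕ l ≡⟨ rz 0 z≤n ⟩
      dz * z 0 - + 0 - w * z 1 ≡⟨ cong₂ (λ a b → dz * a - + 0 - w * b) (proj₁ R0) (proj₂ R0) ⟩
      dz * (adj 0 t * z t) - + 0 - w * (adj 1 t * z t) ≡⟨ helper3 dz w (adj 0 t) (adj 1 t) (z t) ⟩
      (dz * adj 0 t - w * adj 1 t) * z t ≡⟨ cong (λ v → (dz * adj 0 t - w * v) * z t) (sym (adj-one t)) ⟩
      pathDet * z t ≡⟨ cong (_* z t) nv ⟩
      + N * z t ∎
      where
      open ≡-Reasoning
      helper3 : ∀ dz w a b c → dz * (a * c) - + 0 - w * (b * c) ≡ (dz * a - w * b) * c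
      helper3 = solve-∀

  pathQuotientOrder : pathDet ≡ + N → QuotientOrder Supported PathImage N
  pathQuotientOrder nv = reps , reps-supp , cover nv , unique nv

Fibrewise : {I Z : Set} → ((Z → ℤ) → Set) → ((I × Z) → ℤ) → Set
Fibrewise {I} P y = ∀ (i : I) → P (λ z → y (i , z))

Fibrewise-subgroup : {I Z : Set} {P : (Z → ℤ) → Set} → IsSubgroup P → IsSubgroup (Fibrewise {I} P)
Fibrewise-subgroup sP = record
  { ∈-resp = λ eq p i → IsSubgroup.∈-resp sP (λ z → eq (i , z)) (p i)
  ; 𝟘∈ = λ i → IsSubgroup.𝟘∈ sP
  ; +∈ = λ p q i → IsSubgroup.+∈ sP (p i) (q i)
  ; neg∈ = λ p i → IsSubgroup.neg∈ sP (p i) }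

module Reindex {X X' : Set} (f : X' → X) (g : X → X') (fg : ∀ x → f (g x) ≡ x)
  (A L : (X → ℤ) → Set) (sA : IsSubgroup A) (sL : IsSubgroup L) where
  reindex : ∀ {N} → QuotientOrder A L N → QuotientOrder (λ y → A (λ x → y (g x))) (λ y → L (λ x → y (g x))) N
  reindex (r , rA , cov , uq) = r' , r'A , cov' , uq'
    where
    r' = λ k x' → r k (f x')
    r'A = λ k → IsSubgroup.∈-resp sA (λ x → sym (cong (r k) (fg x))) (rA k)
    cov' = λ y ay → let (k , lk) = cov (λ x → y (g x)) ay in
      k , IsSubgroup.∈-resp sL (λ x → cong (λ u → y (g x) - r k u) (sym (fg x))) lk
    uq' = λ k l p → uq k l (IsSubgroup.∈-resp sL (λ x → cong₂ (λ u v → r k u - r l v) (fg x) (fg x)) p)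

fibrewise-Fin : ∀ {Z : Set} (B P : (Z → ℤ) → Set) {N} q → QuotientOrder B P N → QuotientOrder (Fibrewise {Fin q} B) (Fibrewise {Fin q} P) (N ^ q)
fibrewise-Fin B P zero _ = (λ _ → 𝟘) , (λ _ ()) , (λ _ _ → zero , (λ ())) , uq0
  where
  uq0 : ∀ (k l : Fin 1) → _ → k ≡ l
  uq0 zero zero _ = refl
fibrewise-Fin {Z} B P {N} (suc q) h1@(r1 , r1A , cov1 , uq1) = rep , repA , cov , uq
  where
  N2 = N ^ q
  h2 = fibrewise-Fin B P q h1
  r2 = proj₁ h2
  r2A = proj₁ (proj₂ h2)
  cov2 = proj₁ (proj₂ (proj₂ h2))
  uq2 = proj₂ (proj₂ (proj₂ h2))
  rep' : Fin N × Fin N2 → (Fin (suc q) × Z) → ℤ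
  rep' (k1 , k2) (zero , z) = r1 k1 z
  rep' (k1 , k2) (suc i , z) = r2 k2 (i , z)
  rep : Fin (N ℕ.* N2) → (Fin (suc q) × Z) → ℤ
  rep k = rep' (remQuot {N} N2 k)
  repA' : ∀ p → Fibrewise B (rep' p)
  repA' (k1 , k2) zero = r1A k1
  repA' (k1 , k2) (suc i) = r2A k2 i
  repA = λ k → repA' (remQuot {N} N2 k)
  cov : ∀ y → Fibrewise B y → ∃ λ k → Fibrewise P (y -ᵥ rep k)
  cov y by = combine {N} {N2} k1 k2 , subst (λ p → Fibrewise P (y -ᵥ rep' p)) (sym (remQuot-combine {N} {N2} k1 k2)) fin
    where
    c1 = cov1 (λ z → y (zero , z)) (by zero)
    k1 = proj₁ c1
    c2 = cov2 (λ iz → y (suc (proj₁ iz) , proj₂ iz)) (λ i → by (suc i))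
    k2 = proj₁ c2
    fin : Fibrewise P (y -ᵥ rep' (k1 , k2))
    fin zero = proj₂ c1
    fin (suc i) = proj₂ c2 i
  uq : ∀ k l → Fibrewise P (rep k -ᵥ rep l) → k ≡ l
  uq k l p = trans (sym (combine-remQuot {N} N2 k)) (trans (uq' (remQuot {N} N2 k) (remQuot {N} N2 l) p) (combine-remQuot {N} N2 l))
    where
    uq' : ∀ a b → Fibrewise P (rep' a -ᵥ rep' b) → combine {N} {N2} (proj₁ a) (proj₂ a) ≡ combine {N} {N2} (proj₁ b) (proj₂ b)
    uq' (a1 , a2) (b1 , b2) q = cong₂ (combine {N} {N2}) (uq1 a1 b1 (q zero)) (uq2 a2 b2 (λ i → q (suc i)))

fibrewise-Vec : ∀ {Z : Set} (B P : (Z → ℤ) → Set) (sB : IsSubgroup B) (sP : IsSubgroup P) {N} m r →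
  QuotientOrder B P N → QuotientOrder (Fibrewise {Vec (Fin m) r} B) (Fibrewise {Vec (Fin m) r} P) (N ^ (m ^ r))
fibrewise-Vec {Z} B P sB sP {N} m zero (r1 , r1A , cov1 , uq1) =
  subst (QuotientOrder (Fibrewise {Vec (Fin m) 0} B) (Fibrewise P)) (sym (ℕP.*-identityʳ N)) (rep , repA , cov , uq)
  where
  rep = λ k (vz : Vec (Fin m) 0 × Z) → r1 k (proj₂ vz)
  repA : ∀ k → Fibrewise B (rep k)
  repA k [] = r1A k
  cov : ∀ y → Fibrewise B y → ∃ λ k → Fibrewise P (y -ᵥ rep k)
  cov y by = let (k , lk) = cov1 (λ z → y ([] , z)) (by []) in k , λ { [] → lk }
  uq = λ k l p → uq1 k l (p [])
fibrewise-Vec {Z} B P sB sP {N} m (suc r) h =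
  subst (QuotientOrder (Fibrewise {Vec (Fin m) (suc r)} B) (Fibrewise P)) (^-^-comm N (m ^ r) m)
    (QuotientOrder-⇔ (uncurryᵥ {B}) (curryᵥ {B}) (uncurryᵥ {P}) (curryᵥ {P})
      (Reindex.reindex split-head join-head (λ _ → refl) (Fibrewise {Fin m} (Fibrewise {Vec (Fin m) r} B)) (Fibrewise {Fin m} (Fibrewise {Vec (Fin m) r} P))
        (Fibrewise-subgroup (Fibrewise-subgroup sB)) (Fibrewise-subgroup (Fibrewise-subgroup sP))
        (fibrewise-Fin (Fibrewise {Vec (Fin m) r} B) (Fibrewise {Vec (Fin m) r} P) m (fibrewise-Vec B P sB sP m r h))))
  where
  join-head : (Fin m × (Vec (Fin m) r × Z)) → (Vec (Fin m) (suc r) × Z)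
  join-head (c , v , z) = (c ∷ v , z)
  split-head : (Vec (Fin m) (suc r) × Z) → (Fin m × (Vec (Fin m) r × Z))
  split-head (c ∷ v , z) = (c , v , z)
  uncurryᵥ : ∀ {Q : (Z → ℤ) → Set} y → Fibrewise {Fin m} (Fibrewise {Vec (Fin m) r} Q) (λ x → y (join-head x)) → Fibrewise Q y
  uncurryᵥ y p (c ∷ v) = p c v
  curryᵥ : ∀ {Q : (Z → ℤ) → Set} y → Fibrewise Q y → Fibrewise {Fin m} (Fibrewise {Vec (Fin m) r} Q) (λ x → y (join-head x))
  curryᵥ y p c v = p (c ∷ v)
  ^-^-comm : ∀ a b c → (a ^ b) ^ c ≡ a ^ (c ℕ.* b)
  ^-^-comm a b c = trans (ℕP.^-*-assoc a b c) (cong (a ^_) (ℕP.*-comm b c))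

sum-++ : ∀ (xs ys : List ℤ) → sumℤ (xs List.++ ys) ≡ sumℤ xs + sumℤ ys
sum-++ [] ys = sym (ℤP.+-identityˡ _)
sum-++ (x ∷ xs) ys = trans (cong (λ u → x + u) (sum-++ xs ys)) (sym (ℤP.+-assoc x _ _))

module _ {A : Set} where
  sum-map-cong : ∀ (xs : List A) {f g : A → ℤ} → (∀ x → f x ≡ g x) → sumℤ (map f xs) ≡ sumℤ (map g xs)
  sum-map-cong [] _ = refl
  sum-map-cong (x ∷ xs) eq = cong₂ _+_ (eq x) (sum-map-cong xs eq)

  sum-zero : ∀ (xs : List A) (f : A → ℤ) → (∀ x → f x ≡ + 0) → sumℤ (map f xs) ≡ + 0
  sum-zero [] f _ = refl
  sum-zero (x ∷ xs) f eq rewrite eq x = trans (ℤP.+-identityˡ _) (sum-zero xs f eq)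

  sum-add : ∀ (xs : List A) (f g : A → ℤ) → sumℤ (map (λ x → f x + g x) xs) ≡ sumℤ (map f xs) + sumℤ (map g xs)
  sum-add [] f g = refl
  sum-add (x ∷ xs) f g rewrite sum-add xs f g = h (f x) (g x) (sumℤ (map f xs)) (sumℤ (map g xs))
    where
    h : ∀ a b c d → a + b + (c + d) ≡ a + c + (b + d)
    h = solve-∀

  sum-neg : ∀ (xs : List A) (f : A → ℤ) → sumℤ (map (λ x → - f x) xs) ≡ - sumℤ (map f xs)
  sum-neg [] f = refl
  sum-neg (x ∷ xs) f rewrite sum-neg xs f = sym (ℤP.neg-distrib-+ (f x) _)

  sum-sub : ∀ (xs : List A) (f g : A → ℤ) → sumℤ (map (λ x → f x - g x) xs) ≡ sumℤ (map f xs) - sumℤ (map g xs)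
  sum-sub xs f g = trans (sum-add xs f (λ x → - g x)) (cong (λ u → sumℤ (map f xs) + u) (sum-neg xs g))

  sum-scale : ∀ (xs : List A) (a : ℤ) (f : A → ℤ) → sumℤ (map (λ x → a * f x) xs) ≡ a * sumℤ (map f xs)
  sum-scale [] a f = sym (ℤP.*-zeroʳ a)
  sum-scale (x ∷ xs) a f rewrite sum-scale xs a f = sym (ℤP.*-distribˡ-+ a (f x) _)

  sum-concatMap : ∀ {B : Set} (xs : List B) (g : B → List A) (f : A → ℤ) →
    sumℤ (map f (concatMap g xs)) ≡ sumℤ (map (λ x → sumℤ (map f (g x))) xs)
  sum-concatMap [] g f = refl
  sum-concatMap (x ∷ xs) g f = trans (cong sumℤ (LP.map-++ f (g x) (concatMap g xs)))
    (trans (sum-++ (map f (g x)) (map f (concatMap g xs))) (cong (λ u → sumℤ (map f (g x)) + u) (sum-concatMap xs g f)))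

  sum-map-map : ∀ {B : Set} (xs : List B) (g : B → A) (f : A → ℤ) → sumℤ (map f (map g xs)) ≡ sumℤ (map (f ∘ g) xs)
  sum-map-map xs g f = cong sumℤ (sym (LP.map-∘ xs))

sum-swap : ∀ {A B : Set} (xs : List A) (ys : List B) (F : A → B → ℤ) →
  sumℤ (map (λ x → sumℤ (map (F x) ys)) xs) ≡ sumℤ (map (λ y → sumℤ (map (λ x → F x y) xs)) ys)
sum-swap [] ys F = sym (sum-zero ys _ (λ _ → refl))
sum-swap (x ∷ xs) ys F = trans (cong (λ u → sumℤ (map (F x) ys) + u) (sum-swap xs ys F)) (sym (sum-add ys (F x) _))

ΣF : ∀ n → (Fin n → ℤ) → ℤ
ΣF n g = sumℤ (map g (allFin n))

ΣF-suc : ∀ n (g : Fin (suc n) → ℤ) → ΣF (suc n) g ≡ g zero + ΣF n (g ∘ suc)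
ΣF-suc n g = cong (λ l → g zero + sumℤ l) (trans (LP.map-tabulate suc g) (sym (LP.map-tabulate id (g ∘ suc))))

ΣF-single : ∀ n (g : Fin n → ℤ) (a0 : Fin n) → (∀ a → a ≢ a0 → g a ≡ + 0) → ΣF n g ≡ g a0
ΣF-single (suc n) g zero h = trans (ΣF-suc n g) (trans (cong (λ u → g zero + u) (sum-zero (allFin n) (g ∘ suc) (λ a → h (suc a) (λ ())))) (ℤP.+-identityʳ _))
ΣF-single (suc n) g (suc a0) h = trans (ΣF-suc n g) (trans (cong (_+ ΣF n (g ∘ suc)) (h zero (λ ())))
    (trans (ℤP.+-identityˡ _) (ΣF-single n (g ∘ suc) a0 (λ a ne → h (suc a) (λ eq → ne (suc-injective eq))))))

ΣF-const : ∀ n (c : ℤ) → ΣF n (λ _ → c) ≡ + n * c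
ΣF-const zero c = sym (ℤP.*-zeroˡ c)
ΣF-const (suc n) c = trans (ΣF-suc n (λ _ → c)) (trans (cong (λ u → c + u) (ΣF-const n c)) (h n c))
  where
  h : ∀ n c → c + + n * c ≡ + suc n * c
  h n c = trans (cong (_+ + n * c) (sym (ℤP.*-identityˡ c))) (sym (ℤP.*-distribʳ-+ c (+ 1) (+ n)))

-- d = e + 3 and h = h' + 1, so that d ≥ 3 and h ≥ 1 hold by construction; m = d - 1.
module Tree (e h' : ℕ) where

  d h m : ℕ
  d = suc (suc (suc e))
  h = suc h'
  m = suc (suc e)

  VV : Set
  VV = V d h

  basis-refl : ∀ (i : VV) → basis i i ≡ + 1
  basis-refl i with i ≟V i
  ... | yes _ = refl
  ... | no ne = ⊥-elim (ne refl)

  basis-neq : ∀ (i j : VV) → i ≢ j → basis i j ≡ + 0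
  basis-neq i j ne with i ≟V j
  ... | yes eq = ⊥-elim (ne eq)
  ... | no _ = refl

  basis-sym : ∀ (i j : VV) → basis i j ≡ basis j i
  basis-sym i j with i ≟V j
  ... | yes refl = sym (basis-refl i)
  ... | no ne = sym (basis-neq j i (λ eq → ne (sym eq)))

  node-k≢ : ∀ {k k'} .{p p'} {a a' : Fin d} {w : Vec (Fin m) k} {w' : Vec (Fin m) k'} → k ≢ k' →
    _≢_ {A = VV} (node k p a w) (node k' p' a' w')
  node-k≢ ne refl = ne refl

  parentBasis : VV → VV → ℤ
  parentBasis root j = + 0
  parentBasis (node k p a w) j = basis (parentN k p a w) j

  Δ : (VV → ℤ) → VV → ℤ
  Δ c root = + d * c root - sumℤ (map c (children root))
  Δ c (node k p a w) = + d * c (node k p a w) - c (parentN k p a w) - sumℤ (map c (children (node k p a w)))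

  ΣV : ∀ k → (Vec (Fin m) k → ℤ) → ℤ
  ΣV k G = sumℤ (map G (allVec m k))

  ΣV-suc : ∀ k (G : Vec (Fin m) (suc k) → ℤ) → ΣV (suc k) G ≡ ΣF m (λ c → ΣV k (λ w → G (c ∷ w)))
  ΣV-suc k G = trans (sum-concatMap (allFin m) (λ c → map (c ∷_) (allVec m k)) G)
    (sum-map-cong (allFin m) (λ c → sum-map-map (allVec m k) (c ∷_) G))

  ΣV-single : ∀ k (G : Vec (Fin m) k → ℤ) w0 → (∀ w → w ≢ w0 → G w ≡ + 0) → ΣV k G ≡ G w0
  ΣV-single zero G [] hz = ℤP.+-identityʳ (G [])
  ΣV-single (suc k) G (c0 ∷ w0) hz = trans (ΣV-suc k G)
    (trans (ΣF-single m _ c0 (λ c ne → sum-zero (allVec m k) _ (λ w → hz (c ∷ w) (λ { refl → ne refl }))))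
      (ΣV-single k (λ w → G (c0 ∷ w)) w0 (λ w ne → hz (c0 ∷ w) (λ { refl → ne refl }))))

  sum-children-basis : ∀ (i j : VV) → sumℤ (map (λ c → basis c j) (children i)) ≡ parentBasis j i
  sum-children-basis root j with 0 ℕ.<? h
  ... | no ¬q = ⊥-elim (¬q (s≤s z≤n))
  ... | yes q = trans (sum-map-map (allFin d) (λ a → node 0 q a []) (λ c → basis c j)) (go j)
    where
    go : ∀ j → ΣF d (λ a → basis (node 0 q a []) j) ≡ parentBasis j root
    go root = sum-zero (allFin d) (λ a → basis (node 0 q a []) root) (λ a → basis-neq (node 0 q a []) root (λ ()))
    go (node zero p' a' []) = trans (ΣF-single d (λ a → basis (node 0 q a []) (node zero p' a' [])) a'
        (λ a ne → basis-neq (node 0 q a []) (node zero p' a' []) (λ { refl → ne refl })))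
      (trans (basis-refl (node zero p' a' [])) (sym (basis-refl root)))
    go (node (suc k) p' a' (c' ∷ w')) = trans (sum-zero (allFin d) (λ a → basis (node 0 q a []) (node (suc k) p' a' (c' ∷ w')))
        (λ a → basis-neq (node 0 q a []) (node (suc k) p' a' (c' ∷ w')) (node-k≢ (λ ()))))
      (sym (basis-neq (node k (ℕP.<-trans (ℕP.n<1+n k) p') a' w') root (λ ())))
  sum-children-basis (node k p a w) j with suc k ℕ.<? h
  ... | yes q = trans (sum-map-map (allFin m) (λ c → node (suc k) q a (c ∷ w)) (λ c → basis c j)) (go j)
    where
    go : ∀ j → ΣF m (λ c → basis (node (suc k) q a (c ∷ w)) j) ≡ parentBasis j (node k p a w)
    go root = sum-zero (allFin m) (λ c → basis (node (suc k) q a (c ∷ w)) root) (λ c → basis-neq (node (suc k) q a (c ∷ w)) root (λ ()))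
    go (node zero p' a' []) = trans (sum-zero (allFin m) (λ c → basis (node (suc k) q a (c ∷ w)) (node zero p' a' []))
        (λ c → basis-neq (node (suc k) q a (c ∷ w)) (node zero p' a' []) (node-k≢ (λ ()))))
      (sym (basis-neq root (node k p a w) (λ ())))
    go (node (suc k') p' a' (c' ∷ w')) with node k' (ℕP.<-trans (ℕP.n<1+n k') p') a' w' ≟V node k p a w
    ... | yes refl = trans (ΣF-single m (λ c → basis (node (suc k) q a (c ∷ w)) (node (suc k) p' a (c' ∷ w))) c'
        (λ c ne → basis-neq (node (suc k) q a (c ∷ w)) (node (suc k) p' a (c' ∷ w)) (λ { refl → ne refl })))
      (basis-refl (node (suc k) q a (c' ∷ w)))
    ... | no ne = sum-zero (allFin m) (λ c → basis (node (suc k) q a (c ∷ w)) (node (suc k') p' a' (c' ∷ w')))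
        (λ c → basis-neq (node (suc k) q a (c ∷ w)) (node (suc k') p' a' (c' ∷ w')) (λ { refl → ne refl }))
  ... | no ¬q = sym (go j)
    where
    go : ∀ j → parentBasis j (node k p a w) ≡ + 0
    go root = refl
    go (node zero p' a' []) = basis-neq root (node k p a w) (λ ())
    go (node (suc k') p' a' (c' ∷ w')) with node k' (ℕP.<-trans (ℕP.n<1+n k') p') a' w' ≟V node k p a w
    ... | yes refl = ⊥-elim (¬q (recompute (suc k ℕ.<? h) p'))
    ... | no ne = refl

  δ-form : ∀ (i j : VV) → δ i j ≡ + d * basis i j - parentBasis i j - parentBasis j i
  δ-form root j = trans (cong (λ u → + d * basis root j - u) (sum-children-basis root j)) (hh (+ d * basis root j) (parentBasis j root))
    where
    hh : ∀ a y → a - y ≡ a - + 0 - y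
    hh = solve-∀
  δ-form (node k p a w) j = cong (λ u → + d * basis (node k p a w) j - basis (parentN k p a w) j - u) (sum-children-basis (node k p a w) j)

  δ-sym : ∀ (i j : VV) → δ i j ≡ δ j i
  δ-sym i j = trans (δ-form i j) (trans (hδ (+ d) (basis i j) (basis j i) (parentBasis i j) (parentBasis j i) (basis-sym i j)) (sym (δ-form j i)))
    where
    hδ : ∀ D b b' x y → b ≡ b' → D * b - x - y ≡ D * b' - y - x
    hδ D b .b x y refl = solve' D b x y
      where
      solve' : ∀ D b x y → D * b - x - y ≡ D * b - y - x
      solve' = solve-∀

  ΣAll : (VV → ℤ) → ℤ
  ΣAll F = sumℤ (map F (allV d h))

  Rest : (VV → ℤ) → ℤ
  Rest F = ΣF h (λ K → ΣF d (λ a → ΣV (toℕ K) (λ w → F (node (toℕ K) (toℕ<n K) a w))))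

  ΣAll-split : ∀ F → ΣAll F ≡ F root + Rest F
  ΣAll-split F = cong (λ u → F root + u) (trans (sum-concatMap (allFin h) G1 F)
    (sum-map-cong (allFin h) (λ K → trans (sum-concatMap (allFin d) (G2 K) F)
      (sum-map-cong (allFin d) (λ a → sum-map-map (allVec m (toℕ K)) (node (toℕ K) (toℕ<n K) a) F)))))
    where
    G2 : (K : Fin h) → Fin d → List VV
    G2 K a = map (node (toℕ K) (toℕ<n K) a) (allVec m (toℕ K))
    G1 : Fin h → List VV
    G1 K = concatMap (G2 K) (allFin d)

  Rest-zero : ∀ F → (∀ k .p a w → F (node k p a w) ≡ + 0) → Rest F ≡ + 0
  Rest-zero F hz = sum-zero (allFin h) _ (λ K → sum-zero (allFin d) (λ a → ΣV (toℕ K) (λ w → F (node (toℕ K) (toℕ<n K) a w)))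
    (λ a → sum-zero (allVec m (toℕ K)) (λ w → F (node (toℕ K) (toℕ<n K) a w)) (λ w → hz _ _ a w)))

  *-annihilʳ : ∀ x {y} → y ≡ + 0 → x * y ≡ + 0
  *-annihilʳ x refl = ℤP.*-zeroʳ x

  sum-*-basis : ∀ (c : VV → ℤ) (x : VV) → ΣAll (λ i → c i * basis x i) ≡ c x
  sum-*-basis c root = trans (ΣAll-split (λ i → c i * basis root i)) (trans (cong₂ _+_ (trans (cong (λ u → c root * u) (basis-refl root)) (ℤP.*-identityʳ (c root)))
    (Rest-zero (λ i → c i * basis root i) (λ k p a w → *-annihilʳ (c (node k p a w)) (basis-neq root (node k p a w) (λ ()))))) (ℤP.+-identityʳ _))
  sum-*-basis c (node k p a w) = trans (ΣAll-split (λ i → c i * basis x i)) (trans (cong₂ _+_ (*-annihilʳ (c root) (basis-neq x root (λ ()))) restEq) (ℤP.+-identityˡ _))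
    where
    x : VV
    x = node k p a w
    kh : k ℕ.< h
    kh = recompute (k ℕ.<? h) p
    K0 : Fin h
    K0 = fromℕ< kh
    Lk : ∀ k' (pr : k' ℕ.< h) → k' ≡ k → ΣF d (λ a' → ΣV k' (λ w' → c (node k' pr a' w') * basis x (node k' pr a' w'))) ≡ c x
    Lk k' pr refl = trans (ΣF-single d (λ a' → ΣV k (λ w' → c (node k pr a' w') * basis x (node k pr a' w'))) a
        (λ a' ne → sum-zero (allVec m k) (λ w' → c (node k pr a' w') * basis x (node k pr a' w'))
          (λ w' → *-annihilʳ (c (node k pr a' w')) (basis-neq x (node k pr a' w') (λ { refl → ne refl })))))
      (trans (ΣV-single k (λ w' → c (node k pr a w') * basis x (node k pr a w')) w
          (λ w' ne → *-annihilʳ (c (node k pr a w')) (basis-neq x (node k pr a w') (λ { refl → ne refl }))))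
        (trans (cong (λ u → c x * u) (basis-refl x)) (ℤP.*-identityʳ _)))
    restEq : Rest (λ i → c i * basis x i) ≡ c x
    restEq = trans (ΣF-single h (λ K → ΣF d (λ a' → ΣV (toℕ K) (λ w' → c (node (toℕ K) (toℕ<n K) a' w') * basis x (node (toℕ K) (toℕ<n K) a' w')))) K0
        (λ K ne → sum-zero (allFin d) (λ a' → ΣV (toℕ K) (λ w' → c (node (toℕ K) (toℕ<n K) a' w') * basis x (node (toℕ K) (toℕ<n K) a' w')))
          (λ a' → sum-zero (allVec m (toℕ K)) (λ w' → c (node (toℕ K) (toℕ<n K) a' w') * basis x (node (toℕ K) (toℕ<n K) a' w')) (λ w' →
            *-annihilʳ (c (node (toℕ K) (toℕ<n K) a' w')) (basis-neq x (node (toℕ K) (toℕ<n K) a' w') (node-k≢ (λ eq → ne (toℕ-injective (trans (sym eq) (sym (toℕ-fromℕ< kh)))))))))))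
      (Lk (toℕ K0) (toℕ<n K0) (toℕ-fromℕ< kh))

  δ-span≡Δ : ∀ (c : VV → ℤ) (j : VV) → sumℤ (map (λ i → c i * δ i j) (allV d h)) ≡ Δ c j
  δ-span≡Δ c j = trans (sum-map-cong (allV d h) (λ i → cong (λ u → c i * u) (δ-sym i j))) (go j)
    where
    chsum : ∀ (l : List VV) → ΣAll (λ i → c i * sumℤ (map (λ ch → basis ch i) l)) ≡ sumℤ (map c l)
    chsum l = trans (sum-map-cong (allV d h) (λ i → sym (sum-scale l (c i) (λ ch → basis ch i))))
      (trans (sum-swap (allV d h) l (λ i ch → c i * basis ch i)) (sum-map-cong l (λ ch → sum-*-basis c ch)))
    go : ∀ j → ΣAll (λ i → c i * δ j i) ≡ Δ c j
    go root = trans (sum-map-cong (allV d h) (λ i → h1 (c i) (+ d) (basis root i) (sumℤ (map (λ ch → basis ch i) (children root)))))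
      (trans (sum-sub (allV d h) (λ i → + d * (c i * basis root i)) (λ i → c i * sumℤ (map (λ ch → basis ch i) (children root))))
        (cong₂ _-_ (trans (sum-scale (allV d h) (+ d) (λ i → c i * basis root i)) (cong (λ u → + d * u) (sum-*-basis c root))) (chsum (children root))))
      where
      h1 : ∀ x D b s → x * (D * b - s) ≡ D * (x * b) - x * s
      h1 = solve-∀
    go (node k p a w) = trans (sum-map-cong (allV d h) (λ i → h2 (c i) (+ d) (basis x i) (basis (parentN k p a w) i) (sumℤ (map (λ ch → basis ch i) (children x)))))
      (trans (sum-sub (allV d h) (λ i → + d * (c i * basis x i) - c i * basis (parentN k p a w) i) (λ i → c i * sumℤ (map (λ ch → basis ch i) (children x))))
        (cong₂ _-_ (trans (sum-sub (allV d h) (λ i → + d * (c i * basis x i)) (λ i → c i * basis (parentN k p a w) i))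
          (cong₂ _-_ (trans (sum-scale (allV d h) (+ d) (λ i → c i * basis x i)) (cong (λ u → + d * u) (sum-*-basis c x))) (sum-*-basis c (parentN k p a w))))
          (chsum (children x))))
      where
      x : VV
      x = node k p a w
      h2 : ∀ x D b b' s → x * (D * b - b' - s) ≡ D * (x * b) - x * b' - x * s
      h2 = solve-∀

argmax : {A : Set} (f : A → ℤ) (x : A) (ys : List A) → Σ A λ z → (∀ y → y ∈ ys → f y ℤ.≤ f z)
argmax f x [] = x , λ y ()
argmax f x (y ∷ ys) with argmax f x ys
... | (z , bz) with ℤP.≤-total (f z) (f y)
... | inj₁ le = y , λ { y' (here refl) → ℤP.≤-refl ; y' (there mm) → ℤP.≤-trans (bz y' mm) le }
... | inj₂ ge = z , λ { y' (here refl) → ge ; y' (there mm) → bz y' mm }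

+*≤0⇒≤0 : ∀ n M → + suc n * M ℤ.≤ + 0 → M ℤ.≤ + 0
+*≤0⇒≤0 n (+ zero) _ = ℤP.≤-refl
+*≤0⇒≤0 n ℤ.-[1+ x ] _ = -≤+
+*≤0⇒≤0 n (+ suc x) (+≤+ ())

rootIneq : ∀ g0 R M (n : ℕ) → + suc n * M ≡ g0 + R → R ℤ.≤ + n * M → M ℤ.≤ g0
rootIneq g0 R M n eq le = ℤP.0≤i-j⇒j≤i (subst (+ 0 ℤ.≤_) (sym e2) (ℤP.i≤j⇒0≤j-i le))
  where
  e2 : g0 - M ≡ + n * M - R
  e2 = trans (h1 g0 R M (+ n)) (trans (cong (λ u → u - R - M) (sym eq)) (h2 M (+ n) R))
    where
    h1 : ∀ g0 R M n → g0 - M ≡ g0 + R - R - M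
    h1 = solve-∀
    h2 : ∀ M n R → (+ 1 + n) * M - R - M ≡ n * M - R
    h2 = solve-∀

nodeIneq : ∀ P g0 R M (n : ℕ) → + suc (suc n) * M ≡ P + (g0 + R) → P ℤ.≤ M → R ℤ.≤ + n * M → M ℤ.≤ g0
nodeIneq P g0 R M n eq pl le = ℤP.0≤i-j⇒j≤i (subst (+ 0 ℤ.≤_) (sym e2) (ℤP.+-mono-≤ (ℤP.i≤j⇒0≤j-i pl) (ℤP.i≤j⇒0≤j-i le)))
  where
  e2 : g0 - M ≡ (M - P) + (+ n * M - R)
  e2 = trans (h1 P g0 R M) (trans (cong (λ u → u - P - R - M) (sym eq)) (h2 M (+ n) R P))
    where
    h1 : ∀ P g0 R M → g0 - M ≡ P + (g0 + R) - P - R - M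
    h1 = solve-∀
    h2 : ∀ M n R P → (+ 1 + (+ 1 + n)) * M - P - R - M ≡ (M - P) + (n * M - R)
    h2 = solve-∀

leafIneq : ∀ P M (n : ℕ) → + suc (suc n) * M - P - + 0 ≡ + 0 → P ℤ.≤ M → M ℤ.≤ + 0
leafIneq P M n eq pl = +*≤0⇒≤0 n M (subst (ℤ._≤ + 0) (sym e2) (ℤP.i≤j⇒i-j≤0 pl))
  where
  e2 : + suc n * M ≡ P - M
  e2 = trans (h1 M (+ n) P) (trans (cong (_- M) (cong (λ u → u + P) eq)) (h2 P M (+ n)))
    where
    h1 : ∀ M n P → (+ 1 + n) * M ≡ (+ 1 + (+ 1 + n)) * M - P - + 0 + P - M
    h1 = solve-∀
    h2 : ∀ P M n → + 0 + P - M ≡ P - M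
    h2 = solve-∀

ΣF-≤ : ∀ n (g : Fin n → ℤ) M → (∀ a → g a ℤ.≤ M) → ΣF n g ℤ.≤ + n * M
ΣF-≤ zero g M _ = subst (+ 0 ℤ.≤_) (sym (ℤP.*-zeroˡ M)) ℤP.≤-refl
ΣF-≤ (suc n) g M hb = subst (ΣF (suc n) g ℤ.≤_) (sym (h M (+ n))) (subst (ℤ._≤ M + + n * M) (sym (ΣF-suc n g)) (ℤP.+-mono-≤ (hb zero) (ΣF-≤ n (g ∘ suc) M (hb ∘ suc))))
  where
  h : ∀ M n → (+ 1 + n) * M ≡ M + n * M
  h = solve-∀

module MaximumPrinciple (e h' : ℕ) where
  open Tree e h'

  ∈-allVec : ∀ k (w : Vec (Fin m) k) → w ∈ allVec m k
  ∈-allVec zero [] = here refl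
  ∈-allVec (suc k) (c ∷ w) = ∈-concatMap⁺ (λ c' → map (c' ∷_) (allVec m k)) (Any.map (λ { refl → ∈-map⁺ (c ∷_) (∈-allVec k w) }) (∈-allFin c))

  ∈-allV : ∀ (j : VV) → j ∈ allV d h
  ∈-allV root = here refl
  ∈-allV (node k p a w) = there (∈-concatMap⁺ (λ K → concatMap (λ a' → map (node (toℕ K) (toℕ<n K) a') (allVec m (toℕ K))) (allFin d))
      (Any.map (λ {K} eqK → lvl (toℕ K) (toℕ<n K) (trans (cong toℕ (sym eqK)) (toℕ-fromℕ< kh))) (∈-allFin (fromℕ< kh))))
    where
    kh : k ℕ.< h
    kh = recompute (k ℕ.<? h) p
    lvl : ∀ k' (pr : k' ℕ.< h) → k' ≡ k → node k p a w ∈ concatMap (λ a' → map (node k' pr a') (allVec m k')) (allFin d)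
    lvl k' pr refl = ∈-concatMap⁺ (λ a' → map (node k pr a') (allVec m k)) (Any.map (λ { refl → ∈-map⁺ (node k pr a) (∈-allVec k w) }) (∈-allFin a))

  Δ-neg : ∀ c j → Δ (λ i → - c i) j ≡ - Δ c j
  Δ-neg c root = trans (cong (λ u → + d * - c root - u) (sum-neg (children root) c)) (hn (+ d) (c root) (sumℤ (map c (children root))))
    where
    hn : ∀ D x s → D * - x - - s ≡ - (D * x - s)
    hn = solve-∀
  Δ-neg c (node k p a w) = trans (cong (λ u → + d * - c (node k p a w) - - c (parentN k p a w) - u) (sum-neg (children (node k p a w)) c))
      (hn (+ d) (c (node k p a w)) (c (parentN k p a w)) (sumℤ (map c (children (node k p a w)))))
    where
    hn : ∀ D x y s → D * - x - - y - - s ≡ - (D * x - y - s)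
    hn = solve-∀

  -- A maximum of a Δ-harmonic c propagates along first children down to a leaf, where it forces c ≤ 0.
  module AtMaximum (c : VV → ℤ) (harmonic : ∀ j → Δ c j ≡ + 0) (J : VV) (bound : ∀ i → c i ℤ.≤ c J) where
    M = c J

    max-descends : ∀ n k .p a w → k ℕ.+ n ≡ h' → c (node k p a w) ≡ M → Δ c (node k p a w) ≡ + 0 → M ℤ.≤ + 0
    max-descends n k p a w eq c≡M Δc≡0 with suc k ℕ.<? h
    max-descends zero k p a w eq c≡M Δc≡0 | yes q = ⊥-elim (ℕP.<-irrefl (trans (sym (ℕP.+-identityʳ k)) eq) (ℕP.≤-pred q))
    max-descends (suc n) k p a w eq c≡M Δc≡0 | yes q = max-descends n (suc k) q a (zero ∷ w) (trans (sym (ℕP.+-suc k n)) eq) first-child≡M (harmonic (node (suc k) q a (zero ∷ w)))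
      where
      g : Fin m → ℤ
      g c' = c (node (suc k) q a (c' ∷ w))
      ΔM≡0 : + d * M - c (parentN k p a w) - (g zero + ΣF (suc e) (g ∘ suc)) ≡ + 0
      ΔM≡0 = trans (cong (λ u → + d * u - c (parentN k p a w) - (g zero + ΣF (suc e) (g ∘ suc))) (sym c≡M))
             (trans (cong (λ u → + d * c (node k p a w) - c (parentN k p a w) - u) (sym (trans (sum-map-map (allFin m) (λ c' → node (suc k) q a (c' ∷ w)) c) (ΣF-suc (suc e) g)))) Δc≡0)
      dM≡sum : + d * M ≡ c (parentN k p a w) + (g zero + ΣF (suc e) (g ∘ suc))
      dM≡sum = trans (hh (+ d * M) (c (parentN k p a w)) (g zero + ΣF (suc e) (g ∘ suc)))
          (trans (cong (λ u → u + c (parentN k p a w) + (g zero + ΣF (suc e) (g ∘ suc))) ΔM≡0) (cong (λ u → u + (g zero + ΣF (suc e) (g ∘ suc))) (ℤP.+-identityˡ (c (parentN k p a w)))))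
        where
        hh : ∀ x y z → x ≡ (x - y - z) + y + z
        hh = solve-∀
      M≤first-child : M ℤ.≤ g zero
      M≤first-child = nodeIneq (c (parentN k p a w)) (g zero) (ΣF (suc e) (g ∘ suc)) M (suc e) dM≡sum
          (bound (parentN k p a w)) (ΣF-≤ (suc e) (g ∘ suc) M (λ a' → bound (node (suc k) q a (suc a' ∷ w))))
      first-child≡M : c (node (suc k) q a (zero ∷ w)) ≡ M
      first-child≡M = ℤP.≤-antisym (bound (node (suc k) q a (zero ∷ w))) M≤first-child
    max-descends zero k p a w eq c≡M Δc≡0 | no _ = leafIneq (c (parentN k p a w)) M (suc e) (trans (cong (λ u → + d * u - c (parentN k p a w) - + 0) (sym c≡M)) Δc≡0) (bound (parentN k p a w))
    max-descends (suc n) k p a w eq c≡M Δc≡0 | no ¬q = ⊥-elim (¬q (s≤s (subst (suc k ℕ.≤_) eq (subst (ℕ._≤ k ℕ.+ suc n) (ℕP.+-comm k 1) (ℕP.+-monoʳ-≤ k (s≤s z≤n))))))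

    max-at-root : c root ≡ M → Δ c root ≡ + 0 → M ℤ.≤ + 0
    max-at-root c≡M Δc≡0 with 0 ℕ.<? h
    ... | no ¬q = ⊥-elim (¬q (s≤s z≤n))
    ... | yes q = max-descends h' 0 q zero [] refl first-child≡M (harmonic (node 0 q zero []))
      where
      g : Fin d → ℤ
      g a = c (node 0 q a [])
      ΔM≡0 : + d * M - (g zero + ΣF m (g ∘ suc)) ≡ + 0
      ΔM≡0 = trans (cong (λ u → + d * u - (g zero + ΣF m (g ∘ suc))) (sym c≡M))
             (trans (cong (λ u → + d * c root - u) (sym (trans (sum-map-map (allFin d) (λ a → node 0 q a []) c) (ΣF-suc m g)))) Δc≡0)
      dM≡sum : + d * M ≡ g zero + ΣF m (g ∘ suc)
      dM≡sum = trans (hh (+ d * M) (g zero + ΣF m (g ∘ suc))) (trans (cong (λ u → u + (g zero + ΣF m (g ∘ suc))) ΔM≡0) (ℤP.+-identityˡ _))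
        where
        hh : ∀ x y → x ≡ (x - y) + y
        hh = solve-∀
      M≤first-child : M ℤ.≤ g zero
      M≤first-child = rootIneq (g zero) (ΣF m (g ∘ suc)) M m dM≡sum (ΣF-≤ m (g ∘ suc) M (λ a' → bound (node 0 q (suc a') [])))
      first-child≡M : c (node 0 q zero []) ≡ M
      first-child≡M = ℤP.≤-antisym (bound (node 0 q zero [])) M≤first-child

    max≤0 : ∀ j → c j ≡ M → M ℤ.≤ + 0
    max≤0 root c≡M = max-at-root c≡M (harmonic root)
    max≤0 (node k p a w) c≡M = max-descends (h' ℕ.∸ k) k p a w (ℕP.m+[n∸m]≡n (ℕP.≤-pred (recompute (k ℕ.<? h) p))) c≡M (harmonic (node k p a w))

    M≤0 : M ℤ.≤ + 0
    M≤0 = max≤0 J refl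

    ≤0 : ∀ j → c j ℤ.≤ + 0
    ≤0 j = ℤP.≤-trans (bound j) M≤0

  Δ-injective : ∀ (c : VV → ℤ) → (∀ j → Δ c j ≡ + 0) → ∀ j → c j ≡ + 0
  Δ-injective c Δc≡0 j = ℤP.≤-antisym (AtMaximum.≤0 c Δc≡0 (proj₁ max) (λ i → proj₂ max i (∈-allV i)) j) 0≤cj
    where
    max = argmax c root (allV d h)
    min = argmax (λ i → - c i) root (allV d h)
    Δ-c≡0 : ∀ j → Δ (λ i → - c i) j ≡ + 0
    Δ-c≡0 j = trans (Δ-neg c j) (cong -_ (Δc≡0 j))
    0≤cj : + 0 ℤ.≤ c j
    0≤cj = subst (+ 0 ℤ.≤_) (ℤP.neg-involutive (c j))
             (ℤP.neg-mono-≤ (AtMaximum.≤0 (λ i → - c i) Δ-c≡0 (proj₁ min) (λ i → proj₂ min i (∈-allV i)) j))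

swap₀ : ∀ {n} → Fin (suc n) → Fin (suc n) → Fin (suc n)
swap₀ b c with c F.≟ zero
... | yes _ = b
... | no _ with c F.≟ b
...   | yes _ = zero
...   | no _ = c

swap₀-target : ∀ {n} (b : Fin (suc n)) → swap₀ b b ≡ zero
swap₀-target b with b F.≟ zero
... | yes refl = refl
... | no _ with b F.≟ b
...   | yes _ = refl
...   | no ne = ⊥-elim (ne refl)

swap₀-zero : ∀ {n} (c : Fin (suc n)) → swap₀ zero c ≡ c
swap₀-zero c with c F.≟ zero
... | yes eq = sym eq
... | no _ with c F.≟ zero
...   | yes eq = sym eq
...   | no _ = refl

swap₀-other : ∀ {n} (b c : Fin (suc n)) → c ≢ zero → c ≢ b → swap₀ b c ≡ c
swap₀-other b c n0 nb with c F.≟ zero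
... | yes eq = ⊥-elim (n0 eq)
... | no _ with c F.≟ b
...   | yes eq = ⊥-elim (nb eq)
...   | no _ = refl

ΣF-replace : ∀ n (g g' : Fin n → ℤ) i0 → (∀ i → i ≢ i0 → g i ≡ g' i) → ΣF n g ≡ ΣF n g' + (g i0 - g' i0)
ΣF-replace n g g' i0 hh = begin
    ΣF n g ≡⟨ hA (ΣF n g) (ΣF n g') ⟩
    ΣF n g' + (ΣF n g - ΣF n g') ≡⟨ cong (λ u → ΣF n g' + u) (sym (sum-sub (allFin n) g g')) ⟩
    ΣF n g' + ΣF n (λ i → g i - g' i) ≡⟨ cong (λ u → ΣF n g' + u) (ΣF-single n (λ i → g i - g' i) i0 (λ i ne → trans (cong (λ u → u - g' i) (hh i ne)) (ℤP.+-inverseʳ (g' i)))) ⟩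
    ΣF n g' + (g i0 - g' i0) ∎
  where
  open ≡-Reasoning
  hA : ∀ a b → a ≡ b + (a - b)
  hA = solve-∀

ΣF-swap₀ : ∀ n (b : Fin (suc n)) (g : Fin (suc n) → ℤ) → ΣF (suc n) (λ c → g (swap₀ b c)) ≡ ΣF (suc n) g
ΣF-swap₀ n zero g = sum-map-cong (allFin (suc n)) (λ c → cong g (swap₀-zero c))
ΣF-swap₀ n (suc b) g = begin
    ΣF (suc n) (λ c → g (swap₀ (suc b) c)) ≡⟨ ΣF-suc n (λ c → g (swap₀ (suc b) c)) ⟩
    g (suc b) + ΣF n (λ i → g (swap₀ (suc b) (suc i))) ≡⟨ cong (λ u → g (suc b) + u) (ΣF-replace n (λ i → g (swap₀ (suc b) (suc i))) (g ∘ suc) b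
        (λ i ne → cong g (swap₀-other (suc b) (suc i) (λ ()) (λ eq → ne (suc-injective eq))))) ⟩
    g (suc b) + (ΣF n (g ∘ suc) + (g (swap₀ (suc b) (suc b)) - g (suc b))) ≡⟨ cong (λ u → g (suc b) + (ΣF n (g ∘ suc) + (g u - g (suc b)))) (swap₀-target (suc b)) ⟩
    g (suc b) + (ΣF n (g ∘ suc) + (g zero - g (suc b))) ≡⟨ hB (g (suc b)) (ΣF n (g ∘ suc)) (g zero) ⟩
    g zero + ΣF n (g ∘ suc) ≡⟨ sym (ΣF-suc n g) ⟩
    ΣF (suc n) g ∎
  where
  open ≡-Reasoning
  hB : ∀ x s z → x + (s + (z - x)) ≡ z + s
  hB = solve-∀

module Swaps (e h' : ℕ) where
  open Tree e h'
  open MaximumPrinciple e h'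

  -- Digit r is the one followed by exactly r digits, i.e. the choice made at depth r + 2.
  swapDigit : ∀ {k} (r : ℕ) (b : Fin m) → Vec (Fin m) k → Vec (Fin m) k
  swapDigit r b [] = []
  swapDigit r b (_∷_ {k} c w) with k ℕ.≟ r
  ... | yes _ = swap₀ b c ∷ w
  ... | no _ = c ∷ swapDigit r b w

  swapDigit-head : ∀ {k} (b : Fin m) c (w : Vec (Fin m) k) → swapDigit k b (c ∷ w) ≡ swap₀ b c ∷ w
  swapDigit-head {k} b c w with k ℕ.≟ k
  ... | yes _ = refl
  ... | no ne = ⊥-elim (ne refl)

  swapDigit-cons : ∀ {k} r (b : Fin m) c (w : Vec (Fin m) k) → k ≢ r → swapDigit r b (c ∷ w) ≡ c ∷ swapDigit r b w
  swapDigit-cons {k} r b c w ne with k ℕ.≟ r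
  ... | yes eq = ⊥-elim (ne eq)
  ... | no _ = refl

  swapDigit-short : ∀ {k} r (b : Fin m) (w : Vec (Fin m) k) → k ℕ.≤ r → swapDigit r b w ≡ w
  swapDigit-short r b [] _ = refl
  swapDigit-short {suc k} r b (c ∷ w) le = trans (swapDigit-cons r b c w (λ eq → ℕP.<-irrefl eq le)) (cong (c ∷_) (swapDigit-short r b w (ℕP.<⇒≤ le)))

  swapDigit-split : ∀ {s} r (b : Fin m) (pre : Vec (Fin m) s) c (wv : Vec (Fin m) r) → swapDigit r b (pre ++ (c ∷ wv)) ≡ pre ++ (swap₀ b c ∷ wv)
  swapDigit-split r b [] c wv = swapDigit-head b c wv
  swapDigit-split {suc s} r b (p ∷ pre) c wv = trans (swapDigit-cons r b p (pre ++ (c ∷ wv)) (λ eq → ℕP.m≢1+n+m r (sym (trans (sym (ℕP.+-suc s r)) eq)))) (cong (p ∷_) (swapDigit-split r b pre c wv))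

  swapDigit-prefix : ∀ {s n} j (b : Fin m) (pre : Vec (Fin m) s) (rest : Vec (Fin m) n) → n ℕ.≤ j → ∃ λ pre' → swapDigit j b (pre ++ rest) ≡ pre' ++ rest
  swapDigit-prefix j b [] rest le = [] , swapDigit-short j b rest le
  swapDigit-prefix {suc s} {n} j b (p ∷ pre) rest le with (s ℕ.+ n) ℕ.≟ j
  ... | yes _ = (swap₀ b p ∷ pre) , refl
  ... | no _ = let (pre' , eq) = swapDigit-prefix j b pre rest le in (p ∷ pre') , cong (p ∷_) eq

  swapDigit-zero : ∀ {k} r (w : Vec (Fin m) k) → swapDigit r zero w ≡ w
  swapDigit-zero r [] = refl
  swapDigit-zero r (_∷_ {k} c w) with k ℕ.≟ r
  ... | yes _ = cong (_∷ w) (swap₀-zero c)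
  ... | no _ = cong (c ∷_) (swapDigit-zero r w)

  swapAt : ℕ → Fin m → VV → VV
  swapAt r b root = root
  swapAt r b (node k p a w) = node k p a (swapDigit r b w)

  swapBranch : Fin d → VV → VV
  swapBranch b root = root
  swapBranch b (node k p a w) = node k p (swap₀ b a) w

  swapAt-zero : ∀ r u → swapAt r zero u ≡ u
  swapAt-zero r root = refl
  swapAt-zero r (node k p a w) = cong (node k p a) (swapDigit-zero r w)

  swapBranch-zero : ∀ u → swapBranch zero u ≡ u
  swapBranch-zero root = refl
  swapBranch-zero (node k p a w) = cong (λ a' → node k p a' w) (swap₀-zero a)

  Invariant : (VV → VV) → (VV → ℤ) → Set
  Invariant τ x = ∀ u → x (τ u) ≡ x u

  Δ-resp : ∀ {c c' : VV → ℤ} → c ≈ c' → ∀ j → Δ c j ≡ Δ c' j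
  Δ-resp {c} {c'} eq root = cong₂ (λ u v → + d * u - v) (eq root) (sum-map-cong (children root) eq)
  Δ-resp {c} {c'} eq (node k p a w) = cong₂ (λ u v → u - v) (cong₂ (λ u v → + d * u - v) (eq _) (eq _)) (sum-map-cong (children (node k p a w)) eq)

  Δ-sub : ∀ (c c' : VV → ℤ) j → Δ (λ i → c i - c' i) j ≡ Δ c j - Δ c' j
  Δ-sub c c' root = trans (cong (λ u → + d * (c root - c' root) - u) (sum-sub (children root) c c')) (hh (+ d) (c root) (c' root) _ _)
    where
    hh : ∀ D x y s t → D * (x - y) - (s - t) ≡ (D * x - s) - (D * y - t)
    hh = solve-∀
  Δ-sub c c' (node k p a w) = trans (cong (λ u → + d * (c x - c' x) - (c (parentN k p a w) - c' (parentN k p a w)) - u) (sum-sub (children x) c c'))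
      (hh (+ d) (c x) (c' x) (c (parentN k p a w)) (c' (parentN k p a w)) _ _)
    where
    x = node k p a w
    hh : ∀ D x y P Q s t → D * (x - y) - (P - Q) - (s - t) ≡ (D * x - P - s) - (D * y - Q - t)
    hh = solve-∀

  Δ-swapAt : ∀ r b (c : VV → ℤ) j → Δ (λ u → c (swapAt r b u)) j ≡ Δ c (swapAt r b j)
  Δ-swapAt r b c root with 0 ℕ.<? h
  ... | yes q = cong (λ v → + d * c root - v) (trans (sum-map-map (allFin d) (λ a → node 0 q a []) (λ u → c (swapAt r b u))) (sym (sum-map-map (allFin d) (λ a → node 0 q a []) c)))
  ... | no ¬q = ⊥-elim (¬q (s≤s z≤n))
  Δ-swapAt r b c (node k p a w) = cong₂ (λ u v → + d * c (node k p a (swapDigit r b w)) - u - v) (par k p a w) (chl k p a w)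
    where
    par : ∀ k .p a w → c (swapAt r b (parentN k p a w)) ≡ c (parentN k p a (swapDigit r b w))
    par zero p a [] = refl
    par (suc k) p a (c0 ∷ w) with k ℕ.≟ r
    ... | yes refl = cong (λ v → c (node k (ℕP.<-trans (ℕP.n<1+n k) p) a v)) (swapDigit-short k b w ℕP.≤-refl)
    ... | no _ = refl
    chl : ∀ k .p a w → sumℤ (map (λ u → c (swapAt r b u)) (children (node k p a w))) ≡ sumℤ (map c (children (node k p a (swapDigit r b w))))
    chl k p a w with suc k ℕ.<? h
    ... | no _ = refl
    ... | yes q = trans (sum-map-map (allFin m) (λ c' → node (suc k) q a (c' ∷ w)) (λ u → c (swapAt r b u)))
                  (trans (go (k ℕ.≟ r)) (sym (sum-map-map (allFin m) (λ c' → node (suc k) q a (c' ∷ swapDigit r b w)) c)))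
      where
      go : Dec (k ≡ r) → ΣF m (λ c' → c (node (suc k) q a (swapDigit r b (c' ∷ w)))) ≡ ΣF m (λ c' → c (node (suc k) q a (c' ∷ swapDigit r b w)))
      go (yes refl) = trans (sum-map-cong (allFin m) (λ c' → cong (λ v → c (node (suc k) q a v)) (swapDigit-head b c' w)))
        (trans (ΣF-swap₀ (suc e) b (λ c' → c (node (suc k) q a (c' ∷ w)))) (sum-map-cong (allFin m) (λ c' → cong (λ v → c (node (suc k) q a (c' ∷ v))) (sym (swapDigit-short k b w ℕP.≤-refl)))))
      go (no ne) = sum-map-cong (allFin m) (λ c' → cong (λ v → c (node (suc k) q a v)) (swapDigit-cons r b c' w ne))

  Δ-swapBranch : ∀ b (c : VV → ℤ) j → Δ (λ u → c (swapBranch b u)) j ≡ Δ c (swapBranch b j)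
  Δ-swapBranch b c root with 0 ℕ.<? h
  ... | no ¬q = ⊥-elim (¬q (s≤s z≤n))
  ... | yes q = cong (λ v → + d * c root - v) (trans (sum-map-map (allFin d) (λ a → node 0 q a []) (λ u → c (swapBranch b u)))
      (trans (ΣF-swap₀ m b (λ a → c (node 0 q a []))) (sym (sum-map-map (allFin d) (λ a → node 0 q a []) c))))
  Δ-swapBranch b c (node k p a w) = cong₂ (λ u v → + d * c (node k p (swap₀ b a) w) - u - v) (par k p a w) (chl k p a w)
    where
    par : ∀ k .p a w → c (swapBranch b (parentN k p a w)) ≡ c (parentN k p (swap₀ b a) w)
    par zero p a [] = refl
    par (suc k) p a (c0 ∷ w) = refl
    chl : ∀ k .p a w → sumℤ (map (λ u → c (swapBranch b u)) (children (node k p a w))) ≡ sumℤ (map c (children (node k p (swap₀ b a) w)))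
    chl k p a w with suc k ℕ.<? h
    ... | no _ = refl
    ... | yes q = trans (sum-map-map (allFin m) (λ c' → node (suc k) q a (c' ∷ w)) (λ u → c (swapBranch b u)))
                  (sym (sum-map-map (allFin m) (λ c' → node (suc k) q (swap₀ b a) (c' ∷ w)) c))

  Invariant-Δ : ∀ (τ : VV → VV) → (∀ c j → Δ (λ u → c (τ u)) j ≡ Δ c (τ j)) → ∀ c → Invariant τ c → Invariant τ (Δ c)
  Invariant-Δ τ cm c ic u = trans (sym (cm c u)) (Δ-resp ic u)

  -- Δ (c ∘ τ - c) = 0, so c ∘ τ = c by injectivity.
  Invariant-Δ⁻¹ : ∀ (τ : VV → VV) → (∀ c j → Δ (λ u → c (τ u)) j ≡ Δ c (τ j)) → ∀ c → Invariant τ (Δ c) → Invariant τ c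
  Invariant-Δ⁻¹ τ cm c im u = ℤP.i-j≡0⇒i≡j (c (τ u)) (c u) (diff0 u)
    where
    diff0 : ∀ u → c (τ u) - c u ≡ + 0
    diff0 = Δ-injective (λ u → c (τ u) - c u) (λ j → trans (Δ-sub (λ u → c (τ u)) c j) (trans (cong (λ v → v - Δ c j) (cm c j)) (trans (cong (λ v → v - Δ c j) (im j)) (ℤP.+-inverseʳ (Δ c j)))))

module Invariance (e h' : ℕ) where
  open Tree e h'
  open MaximumPrinciple e h'
  open Swaps e h'

  prefix-irrelevant : ∀ {n} s (g : Vec (Fin m) (s ℕ.+ n) → ℤ) → (∀ j b w → n ℕ.≤ j → g (swapDigit j b w) ≡ g w) →
    ∀ (pre pre' : Vec (Fin m) s) (rest : Vec (Fin m) n) → g (pre ++ rest) ≡ g (pre' ++ rest)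
  prefix-irrelevant zero g hg [] [] rest = refl
  prefix-irrelevant {n} (suc s) g hg (p ∷ pr) (p' ∷ pr') rest =
    trans (toZ p (pr ++ rest)) (trans (prefix-irrelevant s (λ v → g (zero ∷ v)) hg' pr pr' rest) (sym (toZ p' (pr' ++ rest))))
    where
    toZ : ∀ p v → g (p ∷ v) ≡ g (zero ∷ v)
    toZ p v = trans (cong g (sym (swapDigit-head p zero v))) (hg (s ℕ.+ n) p (zero ∷ v) (ℕP.m≤n+m n s))
    hg' : ∀ j b w → n ℕ.≤ j → g (zero ∷ swapDigit j b w) ≡ g (zero ∷ w)
    hg' j b w le with (s ℕ.+ n) ℕ.≟ j
    ... | yes refl = cong (λ v → g (zero ∷ v)) (swapDigit-short j b w ℕP.≤-refl)
    ... | no ne = trans (cong g (sym (swapDigit-cons j b zero w ne))) (hg j b (zero ∷ w) le)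

  all-irrelevant : ∀ k (g : Vec (Fin m) k → ℤ) → (∀ j b w → g (swapDigit j b w) ≡ g w) → ∀ w w' → g w ≡ g w'
  all-irrelevant zero g hg [] [] = refl
  all-irrelevant (suc k) g hg (p ∷ v) (p' ∷ v') =
    trans (toZ p v) (trans (all-irrelevant k (λ u → g (zero ∷ u)) hg' v v') (sym (toZ p' v')))
    where
    toZ : ∀ p v → g (p ∷ v) ≡ g (zero ∷ v)
    toZ p v = trans (cong g (sym (swapDigit-head p zero v))) (hg k p (zero ∷ v))
    hg' : ∀ j b w → g (zero ∷ swapDigit j b w) ≡ g (zero ∷ w)
    hg' j b w with k ℕ.≟ j
    ... | yes refl = cong (λ v → g (zero ∷ v)) (swapDigit-short j b w ℕP.≤-refl)
    ... | no ne = trans (cong g (sym (swapDigit-cons j b zero w ne))) (hg j b (zero ∷ w))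

  InvariantFrom : ℕ → (VV → ℤ) → Set
  InvariantFrom ρ x = ∀ j b → ρ ℕ.≤ j → Invariant (swapAt j b) x

  digits-irrelevant : ∀ r x → InvariantFrom (suc r) x → ∀ s .pr a (pre pre' : Vec (Fin m) s) c (wv : Vec (Fin m) r) →
    x (node (s ℕ.+ suc r) pr a (pre ++ (c ∷ wv))) ≡ x (node (s ℕ.+ suc r) pr a (pre' ++ (c ∷ wv)))
  digits-irrelevant r x px s pr a pre pre' c wv = prefix-irrelevant s (λ w → x (node (s ℕ.+ suc r) pr a w)) (λ j b w le → px j b le (node _ pr a w)) pre pre' (c ∷ wv)

  radial : ∀ x → InvariantFrom 0 x → ∀ k .pr a (w w' : Vec (Fin m) k) → x (node k pr a w) ≡ x (node k pr a w')
  radial x px k pr a w w' = all-irrelevant k (λ w → x (node k pr a w)) (λ j b w → px j b z≤n (node _ pr a w)) w w'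

  ΔImage : ((VV → ℤ) → Set) → (VV → ℤ) → Set
  ΔImage A x = ∃ λ c → A c × (∀ j → x j ≡ Δ c j)

  Δ-add : ∀ (c c' : VV → ℤ) j → Δ (λ i → c i + c' i) j ≡ Δ c j + Δ c' j
  Δ-add c c' j = trans (Δ-resp (λ i → hh (c i) (c' i)) j) (trans (Δ-sub c (λ i → - c' i) j) (trans (cong (λ u → Δ c j - u) (Δ-neg c' j)) (sym (hh (Δ c j) (Δ c' j)))))
    where
    hh : ∀ a b → a + b ≡ a - - b
    hh = solve-∀

  Δ-zero : ∀ j → Δ 𝟘 j ≡ + 0
  Δ-zero j = trans (Δ-resp (λ i → sym (ℤP.+-inverseʳ (+ 0))) j) (trans (Δ-sub 𝟘 𝟘 j) (ℤP.+-inverseʳ (Δ 𝟘 j)))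

  ΔImage-subgroup : ∀ (A : (VV → ℤ) → Set) → IsSubgroup A → IsSubgroup (ΔImage A)
  ΔImage-subgroup A sA = record
    { ∈-resp = λ {x} {y} eq (c , ac , ex) → c , ac , (λ j → trans (sym (eq j)) (ex j))
    ; 𝟘∈ = 𝟘 , IsSubgroup.𝟘∈ sA , (λ j → sym (Δ-zero j))
    ; +∈ = λ {x} {y} (c , ac , ex) (c' , ac' , ey) → (c +ᵥ c') , IsSubgroup.+∈ sA ac ac' , (λ j → trans (cong₂ _+_ (ex j) (ey j)) (sym (Δ-add c c' j)))
    ; neg∈ = λ {x} (c , ac , ex) → (λ i → - c i) , IsSubgroup.neg∈ sA ac , (λ j → trans (cong -_ (ex j)) (sym (Δ-neg c j))) }

  Invariant-subgroup : ∀ τ → IsSubgroup (Invariant τ)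
  Invariant-subgroup τ = record
    { ∈-resp = λ {x} {y} eq ix u → trans (sym (eq (τ u))) (trans (ix u) (eq u))
    ; 𝟘∈ = λ u → refl
    ; +∈ = λ ix iy u → cong₂ _+_ (ix u) (iy u)
    ; neg∈ = λ ix u → cong -_ (ix u) }

  InvariantFrom-subgroup : ∀ ρ → IsSubgroup (InvariantFrom ρ)
  InvariantFrom-subgroup ρ = Π-subgroup λ j → Π-subgroup λ b → Π-subgroup λ _ → Invariant-subgroup (swapAt j b)

  InvariantFrom-Δ : ∀ ρ c → InvariantFrom ρ c → InvariantFrom ρ (Δ c)
  InvariantFrom-Δ ρ c pc j b le = Invariant-Δ (swapAt j b) (Δ-swapAt j b) c (pc j b le)

  data SplitV (r : ℕ) : (k : ℕ) → Vec (Fin m) k → Set where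
    short : ∀ {k} {w : Vec (Fin m) k} → k ℕ.≤ r → SplitV r k w
    split : ∀ {s} (pre : Vec (Fin m) s) (c : Fin m) (wv : Vec (Fin m) r) → SplitV r (s ℕ.+ suc r) (pre ++ (c ∷ wv))

  splitV : ∀ r {k} (w : Vec (Fin m) k) → SplitV r k w
  splitV r [] = short z≤n
  splitV r (_∷_ {k} c w) with k ℕ.≟ r
  ... | yes refl = split [] c w
  ... | no ne with splitV r w
  ...   | short le = short (ℕP.≤∧≢⇒< le ne)
  ...   | split pre c' wv = split (c ∷ pre) c' wv

  splitV-eq : ∀ r {s} (pre : Vec (Fin m) s) c (wv : Vec (Fin m) r) → splitV r (pre ++ (c ∷ wv)) ≡ split pre c wv
  splitV-eq r [] c wv with r ℕ.≟ r
  ... | yes refl = refl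
  ... | no ne = ⊥-elim (ne refl)
  splitV-eq r {suc s} (p ∷ pre) c wv with (s ℕ.+ suc r) ℕ.≟ r
  ... | yes eq = ⊥-elim (ℕP.m≢1+n+m r (sym (trans (sym (ℕP.+-suc s r)) eq)))
  ... | no ne rewrite splitV-eq r pre c wv = refl

  zeros : ∀ s → Vec (Fin m) s
  zeros s = replicate s zero

repunit : ℕ → ℕ → ℕ
repunit m zero = 0
repunit m (suc n) = suc (m ℕ.* repunit m n)

repunit-suc : ∀ m n → repunit m (suc n) ≡ m ^ n ℕ.+ repunit m n
repunit-suc m zero = cong suc (ℕP.*-zeroʳ m)
repunit-suc m (suc n) = begin
    suc (m ℕ.* repunit m (suc n)) ≡⟨ cong (λ u → suc (m ℕ.* u)) (repunit-suc m n) ⟩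
    suc (m ℕ.* (m ^ n ℕ.+ repunit m n)) ≡⟨ hN m (m ^ n) (repunit m n) ⟩
    m ℕ.* m ^ n ℕ.+ suc (m ℕ.* repunit m n) ∎
  where
  open ≡-Reasoning
  hN : ∀ a b c → suc (a ℕ.* (b ℕ.+ c)) ≡ a ℕ.* b ℕ.+ suc (a ℕ.* c)
  hN = NS.solve-∀

+repunit-suc : ∀ m n → + repunit m (suc n) ≡ + 1 + + m * + repunit m n
+repunit-suc m n = trans (ℤP.pos-+ 1 (m ℕ.* repunit m n)) (cong (λ u → + 1 + u) (ℤP.pos-* m (repunit m n)))

module PathRepunit (m : ℕ) (w : ℤ) (t N : ℕ) {{nz : ℕ.NonZero N}} where
  open PathLattice (+ suc m) (+ m) w t N

  minors≡repunit : ∀ j → minors j ≡ (+ repunit m j , + repunit m (suc j))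
  minors≡repunit zero = cong (λ u → (+ 0 , + suc u)) (sym (ℕP.*-zeroʳ m))
  minors≡repunit (suc j) rewrite minors≡repunit j = cong (+ repunit m (suc j) ,_) (begin
    + suc m * + repunit m (suc j) - + m * + repunit m j
      ≡⟨ cong₂ (λ u v → u * v - + m * + repunit m j) (ℤP.pos-+ 1 m) (+repunit-suc m j) ⟩
    (+ 1 + + m) * (+ 1 + + m * + repunit m j) - + m * + repunit m j
      ≡⟨ expand (+ m) (+ repunit m j) ⟩
    + 1 + + m * (+ 1 + + m * + repunit m j)
      ≡⟨ cong (λ u → + 1 + + m * u) (+repunit-suc m j) ⟨
    + 1 + + m * + repunit m (suc j)
      ≡⟨ +repunit-suc m (suc j) ⟨
    + repunit m (suc (suc j)) ∎)
    where
    open ≡-Reasoning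
    expand : ∀ a x → (+ 1 + a) * (+ 1 + a * x) - a * x ≡ + 1 + a * (+ 1 + a * x)
    expand = solve-∀

module BranchDet (m t : ℕ) where
  N = repunit m (suc (suc t))
  instance
    nzN : ℕ.NonZero N
    nzN = _
  open PathLattice (+ suc m) (+ m) (+ m) t N
  open PathRepunit m (+ m) t N

  branchDet : pathDet ≡ + N
  branchDet = cong proj₂ (minors≡repunit (suc t))

module RadialDet (m t : ℕ) {{nzm : ℕ.NonZero m}} where
  N = suc m ℕ.* m ^ t
  instance
    nzN : ℕ.NonZero N
    nzN = ℕP.m*n≢0 (suc m) (m ^ t) {{_}} {{ℕP.m^n≢0 m t}}
  open PathLattice (+ suc m) (+ m) (+ suc m) t N
  open PathRepunit m (+ suc m) t N
  radialDet : pathDet ≡ + N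
  radialDet rewrite minors≡repunit t = begin
      + suc m * + repunit m (suc t) - + suc m * + repunit m t ≡⟨ cong (λ u → + suc m * u - + suc m * + repunit m t) (trans (cong +_ (repunit-suc m t)) (ℤP.pos-+ (m ^ t) (repunit m t))) ⟩
      + suc m * (+ (m ^ t) + + repunit m t) - + suc m * + repunit m t ≡⟨ hZ (+ suc m) (+ (m ^ t)) (+ repunit m t) ⟩
      + suc m * + (m ^ t) ≡⟨ sym (ℤP.pos-* (suc m) (m ^ t)) ⟩
      + N ∎
    where
    open ≡-Reasoning
    hZ : ∀ a p x → a * (p + x) - a * x ≡ a * p
    hZ = solve-∀

module LevelStages (e h' : ℕ) where
  open Tree e h'
  open MaximumPrinciple e h'
  open Swaps e h'
  open Invariance e h'

  LevelStage : ℕ → ℕ → (VV → ℤ) → Set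
  LevelStage r β x = InvariantFrom (suc r) x × (∀ (b' : Fin (suc e)) → toℕ b' ℕ.< β → Invariant (swapAt r (suc b')) x)

  LevelStage-subgroup : ∀ r β → IsSubgroup (LevelStage r β)
  LevelStage-subgroup r β =
    ×-subgroup (InvariantFrom-subgroup (suc r)) (Π-subgroup λ b' → Π-subgroup λ _ → Invariant-subgroup (swapAt r (suc b')))

  LevelStage-Δ : ∀ r β c → LevelStage r β c → LevelStage r β (Δ c)
  LevelStage-Δ r β c (p , q) = InvariantFrom-Δ (suc r) c p , (λ b' lt → Invariant-Δ (swapAt r (suc b')) (Δ-swapAt r (suc b')) c (q b' lt))

module LevelStep (e h' : ℕ) (r : ℕ) (hr : suc r ℕ.≤ h') (b0' : Fin (suc e)) where
  open Tree e h'
  open MaximumPrinciple e h'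
  open Swaps e h'
  open Invariance e h'
  open LevelStages e h'

  β : ℕ
  β = toℕ b0'
  b0 : Fin m
  b0 = suc b0'
  t : ℕ
  t = h' ℕ.∸ suc r

  Npath : ℕ
  Npath = repunit m (suc (suc t))
  open BranchDet m t using (nzN; branchDet)
  open PathLattice (+ d) (+ m) (+ m) t Npath

  Y : Set
  Y = Fin d × (Vec (Fin m) r × ℕ)

  bnd : ∀ {s} → s ℕ.≤ t → s ℕ.+ suc r ℕ.< h
  bnd {s} le = s≤s (ℕP.m≤o∸n⇒m+n≤o s hr le)

  bndS : ∀ {s} → suc (s ℕ.+ suc r) ℕ.< h → suc s ℕ.≤ t
  bndS {s} (s≤s le) = ℕP.m+n≤o⇒m≤o∸n (suc s) le

  bndV : ∀ {s} → s ℕ.+ suc r ℕ.< h → s ℕ.≤ t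
  bndV {s} (s≤s le) = ℕP.m+n≤o⇒m≤o∸n s le

  pathVertex : Fin m → Fin d → Vec (Fin m) r → (s : ℕ) → .(s ℕ.≤ t) → VV
  pathVertex cc a wv s le = node (s ℕ.+ suc r) (bnd le) a (zeros s ++ (cc ∷ wv))

  column : (VV → ℤ) → Fin m → Fin d → Vec (Fin m) r → ℕ → ℤ
  column x cc a wv = restrict t (λ s le → x (pathVertex cc a wv s le))

  πv : (VV → ℤ) → Fin d → Vec (Fin m) r → ℕ → ℤ
  πv x a wv = RestrictedDifference.diff (pathVertex b0 a wv) (pathVertex zero a wv) x

  πv-yes : ∀ x a wv s (le : s ℕ.≤ t) → πv x a wv s ≡ x (pathVertex b0 a wv s le) - x (pathVertex zero a wv s le)
  πv-yes x a wv = restrict-≤ _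

  πv-column : ∀ x a wv s → πv x a wv s ≡ column x b0 a wv s - column x zero a wv s
  πv-column x a wv = restrict-zip _-_ refl _ _

  -- π x (a , wv , s) compares x on the b0-child and on the 0-child at level r, s steps further down
  -- the all-zero path; σ puts y back on every vertex whose digit r is b0.
  π : (VV → ℤ) → Y → ℤ
  π x (a , wv , s) = πv x a wv s

  module _ (c : VV → ℤ) (pc : InvariantFrom (suc r) c) (a : Fin d) (wv : Vec (Fin m) r) where
    sum-children-column : ∀ cc s (le : s ℕ.≤ t) → sumℤ (map c (children (pathVertex cc a wv s le))) ≡ + m * column c cc a wv (suc s)
    sum-children-column cc s le with suc (s ℕ.+ suc r) ℕ.<? h | suc s ℕ.≤? t
    ... | yes q | yes le' = trans (sum-map-map (allFin m) (λ c' → node (suc (s ℕ.+ suc r)) q a (c' ∷ (zeros s ++ (cc ∷ wv)))) c)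
        (trans (sum-map-cong (allFin m) (λ c' → digits-irrelevant r c pc (suc s) q a (c' ∷ zeros s) (zeros (suc s)) cc wv))
          (ΣF-const m (c (pathVertex cc a wv (suc s) le'))))
    ... | yes q | no ¬le' = ⊥-elim (¬le' (bndS q))
    ... | no ¬q | yes le' = ⊥-elim (¬q (bnd le'))
    ... | no _ | no _ = sym (ℤP.*-zeroʳ (+ m))

    π-Δ : ∀ s (le : s ℕ.≤ t) → πv (Δ c) a wv s ≡ row (πv c a wv) s
    π-Δ s le = begin
      πv (Δ c) a wv s
        ≡⟨ πv-yes (Δ c) a wv s le ⟩
      Δ c u₁ - Δ c u₀
        ≡⟨ cong₂ (λ x y → (+ d * c u₁ - c p₁ - x) - (+ d * c u₀ - c p₀ - y)) (sum-children-column b0 s le) (sum-children-column zero s le) ⟩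
      (+ d * c u₁ - c p₁ - + m * n₁) - (+ d * c u₀ - c p₀ - + m * n₀)
        ≡⟨ difference-of-rows (+ d) (+ m) (c u₁) (c u₀) (c p₁) (c p₀) n₁ n₀ ⟩
      + d * (c u₁ - c u₀) - (c p₁ - c p₀) - + m * (n₁ - n₀)
        ≡⟨ cong₃ (λ x y z → + d * x - y - z) (sym (πv-yes c a wv s le)) (π-parent s le) (cong₂ _*_ (sym (wt≡ refl s)) (sym (πv-column c a wv (suc s)))) ⟩
      row (πv c a wv) s ∎
      where
      open ≡-Reasoning
      u₁ u₀ p₁ p₀ : VV
      u₁ = pathVertex b0 a wv s le
      u₀ = pathVertex zero a wv s le
      p₁ = parentN (s ℕ.+ suc r) (bnd le) a (zeros s ++ (b0 ∷ wv))
      p₀ = parentN (s ℕ.+ suc r) (bnd le) a (zeros s ++ (zero ∷ wv))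
      n₁ n₀ : ℤ
      n₁ = column c b0 a wv (suc s)
      n₀ = column c zero a wv (suc s)
      π-parent : ∀ s (le : s ℕ.≤ t) → c (parentN (s ℕ.+ suc r) (bnd le) a (zeros s ++ (b0 ∷ wv))) - c (parentN (s ℕ.+ suc r) (bnd le) a (zeros s ++ (zero ∷ wv))) ≡ pre (πv c a wv) s
      π-parent zero le = ℤP.+-inverseʳ (c (node r (ℕP.<-trans (ℕP.n<1+n r) (bnd le)) a wv))
      π-parent (suc s) le = sym (πv-yes c a wv s (ℕP.<⇒≤ le))

  σv : (Y → ℤ) → Fin d → ∀ {k} {w : Vec (Fin m) k} → SplitV r k w → ℤ
  σv y a (short _) = + 0
  σv y a (split {s} pre c wv) with c F.≟ b0
  ... | yes _ = y (a , wv , s)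
  ... | no _ = + 0

  σ : (Y → ℤ) → VV → ℤ
  σ y root = + 0
  σ y (node k p a w) = σv y a (splitV r w)

  σ-at : ∀ y s .p a (pre : Vec (Fin m) s) c wv → σ y (node (s ℕ.+ suc r) p a (pre ++ (c ∷ wv))) ≡ σv y a (split pre c wv)
  σ-at y s p a pre c wv = cong (σv y a) (splitV-eq r pre c wv)

  σv-b0 : ∀ y a {s} (pre : Vec (Fin m) s) wv → σv y a (split pre b0 wv) ≡ y (a , wv , s)
  σv-b0 y a pre wv with b0 F.≟ b0
  ... | yes _ = refl
  ... | no ne = ⊥-elim (ne refl)

  σv-ne : ∀ y a {s} (pre : Vec (Fin m) s) c wv → c ≢ b0 → σv y a (split pre c wv) ≡ + 0
  σv-ne y a pre c wv ne with c F.≟ b0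
  ... | yes eq = ⊥-elim (ne eq)
  ... | no _ = refl

  σv-pre : ∀ y a {s} (pre pre' : Vec (Fin m) s) c wv → σv y a (split pre c wv) ≡ σv y a (split pre' c wv)
  σv-pre y a pre pre' c wv with c F.≟ b0
  ... | yes _ = refl
  ... | no _ = refl

  B : (Y → ℤ) → Set
  B = Fibrewise {Fin d} (Fibrewise {Vec (Fin m) r} Supported)
  LB : (Y → ℤ) → Set
  LB = Fibrewise {Fin d} (Fibrewise {Vec (Fin m) r} PathImage)

  πσ : ∀ y → B y → π (σ y) ≈ y
  πσ y By (a , wv , s) with s ℕ.≤? t
  ... | yes le = trans (cong₂ _-_ (trans (σ-at y s (bnd le) a (zeros s) b0 wv) (σv-b0 y a (zeros s) wv)) (trans (σ-at y s (bnd le) a (zeros s) zero wv) (σv-ne y a (zeros s) zero wv (λ ()))))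
                    (ℤP.+-identityʳ (y (a , wv , s)))
  ... | no ¬le = sym (By a wv s (ℕP.≰⇒> ¬le))

  σ-InvariantFrom : ∀ y → InvariantFrom (suc r) (σ y)
  σ-InvariantFrom y j b le root = refl
  σ-InvariantFrom y j b le (node k p a w) = go {p = p} (splitV r w)
    where
    go : ∀ {k} {w : Vec (Fin m) k} .{p} → SplitV r k w → σ y (node k p a (swapDigit j b w)) ≡ σ y (node k p a w)
    go {k} {w = w} {p} (short le') = cong (λ v → σ y (node k p a v)) (swapDigit-short j b w (ℕP.≤-trans le' (ℕP.<⇒≤ le)))
    go {p = p} (split {s} pre c wv) with swapDigit-prefix j b pre (c ∷ wv) le
    ... | (pre' , eq) = trans (cong (λ v → σ y (node _ p a v)) eq) (trans (σ-at y s p a pre' c wv) (trans (σv-pre y a pre' pre c wv) (sym (σ-at y s p a pre c wv))))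

  σv-swap₀ : ∀ y a {s} (pre : Vec (Fin m) s) c wv (b'' : Fin (suc e)) → b'' ≢ b0' → σv y a (split pre (swap₀ (suc b'') c) wv) ≡ σv y a (split pre c wv)
  σv-swap₀ y a pre c wv b'' ne with c F.≟ zero
  ... | yes refl = trans (σv-ne y a pre (suc b'') wv (λ eq → ne (suc-injective eq))) (sym (σv-ne y a pre zero wv (λ ())))
  ... | no c≢0 with c F.≟ suc b''
  ...   | yes refl = trans (σv-ne y a pre zero wv (λ ())) (sym (σv-ne y a pre (suc b'') wv (λ eq → ne (suc-injective eq))))
  ...   | no _ = refl

  σ∈A : ∀ y → LevelStage r β (σ y)
  σ∈A y = σ-InvariantFrom y , inv
    where
    inv : ∀ (b' : Fin (suc e)) → toℕ b' ℕ.< β → Invariant (swapAt r (suc b')) (σ y)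
    inv b' lt root = refl
    inv b' lt (node k p a w) = go {p = p} (splitV r w)
      where
      go : ∀ {k} {w : Vec (Fin m) k} .{p} → SplitV r k w → σ y (node k p a (swapDigit r (suc b') w)) ≡ σ y (node k p a w)
      go {k} {w = w} {p} (short le') = cong (λ v → σ y (node k p a v)) (swapDigit-short r (suc b') w le')
      go {p = p} (split {s} pre c wv) = trans (cong (λ v → σ y (node _ p a v)) (swapDigit-split r (suc b') pre c wv))
        (trans (σ-at y s p a pre (swap₀ (suc b') c) wv) (trans (σv-swap₀ y a pre c wv b' (λ eq → ℕP.<-irrefl (cong toℕ eq) lt)) (sym (σ-at y s p a pre c wv))))

  π-resp : ∀ {x y} → x ≈ y → π x ≈ π y
  π-resp eq (a , wv , s) = RestrictedDifference.diff-resp (pathVertex b0 a wv) (pathVertex zero a wv) eq s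

  π-add : ∀ x y → π (x +ᵥ y) ≈ π x +ᵥ π y
  π-add x y (a , wv , s) = RestrictedDifference.diff-+ (pathVertex b0 a wv) (pathVertex zero a wv) x y s

  π-sub : ∀ x y → π (x -ᵥ y) ≈ π x -ᵥ π y
  π-sub x y (a , wv , s) = RestrictedDifference.diff-- (pathVertex b0 a wv) (pathVertex zero a wv) x y s

  π∈B : ∀ x → LevelStage r β x → B (π x)
  π∈B x _ a wv s lt = restrict-> _ s lt

  π∈LB : ∀ x → LevelStage r β x → ΔImage (LevelStage r β) x → LB (π x)
  π∈LB x _ (c , ac , ex) a wv = (λ s → πv c a wv s) , (λ s lt → restrict-> _ s lt) ,
    (λ s le → trans (π-resp ex (a , wv , s)) (π-Δ c (proj₁ ac) a wv s le))

  lift : ∀ y → B y → LB y → ∃ λ ℓ → LevelStage r β ℓ × ΔImage (LevelStage r β) ℓ × π ℓ ≈ y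
  lift y By LBy = Δ c , LevelStage-Δ r β c (σ∈A z) , (c , σ∈A z , λ j → refl) , eqπ
    where
    z : Y → ℤ
    z (a , wv , s) = proj₁ (LBy a wv) s
    zB : B z
    zB a wv = proj₁ (proj₂ (LBy a wv))
    c = σ z
    eqπ : π (Δ c) ≈ y
    eqπ (a , wv , s) with s ℕ.≤? t
    ... | no ¬le = sym (By a wv s (ℕP.≰⇒> ¬le))
    ... | yes le = trans (sym (πv-yes (Δ c) a wv s le)) (trans (π-Δ c (proj₁ (σ∈A z)) a wv s le)
        (trans (row-cong (λ s' → πσ z zB (a , wv , s')) s) (sym (proj₂ (proj₂ (LBy a wv)) s le))))

  A'⊆A : ∀ x → LevelStage r (suc β) x → LevelStage r β x
  A'⊆A x (p , q) = p , (λ b' lt → q b' (ℕP.m<n⇒m<1+n lt))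

  swapAt-pathVertex : ∀ a wv s (le : s ℕ.≤ t) → swapAt r b0 (pathVertex zero a wv s le) ≡ pathVertex b0 a wv s le
  swapAt-pathVertex a wv s le = cong (node (s ℕ.+ suc r) (bnd le) a) (swapDigit-split r b0 (zeros s) zero wv)

  π-A' : ∀ x → LevelStage r (suc β) x → π x ≈ 𝟘
  π-A' x (p , q) (a , wv , s) with s ℕ.≤? t
  ... | no _ = refl
  ... | yes le = trans (cong (λ u → x u - x (pathVertex zero a wv s le)) (sym (swapAt-pathVertex a wv s le)))
      (trans (cong (λ u → u - x (pathVertex zero a wv s le)) (q b0' ℕP.≤-refl (pathVertex zero a wv s le))) (ℤP.+-inverseʳ (x (pathVertex zero a wv s le))))

  ker⊆A' : ∀ x → LevelStage r β x → π x ≈ 𝟘 → LevelStage r (suc β) x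
  ker⊆A' x (px , q) πz = px , q'
    where
    value-b₀≡value-0 : ∀ a wv s (le : s ℕ.≤ t) → x (pathVertex b0 a wv s le) ≡ x (pathVertex zero a wv s le)
    value-b₀≡value-0 a wv s le = ℤP.i-j≡0⇒i≡j _ _ (trans (sym (πv-yes x a wv s le)) (πz (a , wv , s)))
    invariant-b₀ : Invariant (swapAt r b0) x
    invariant-b₀ root = refl
    invariant-b₀ (node k p' a w) = go {p = p'} (splitV r w)
      where
      go : ∀ {k} {w : Vec (Fin m) k} .{p} → SplitV r k w → x (node k p a (swapDigit r b0 w)) ≡ x (node k p a w)
      go {k} {w = w} {p} (short le') = cong (λ v → x (node k p a v)) (swapDigit-short r b0 w le')
      go {p = p} (split {s} pre c wv) = trans (cong (λ v → x (node _ p a v)) (swapDigit-split r b0 pre c wv))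
          (trans (digits-irrelevant r x px s p a pre (zeros s) (swap₀ b0 c) wv) (trans (cases c) (sym (digits-irrelevant r x px s p a pre (zeros s) c wv))))
        where
        le : s ℕ.≤ t
        le = bndV (recompute (_ ℕ.<? h) p)
        cases : ∀ c → x (pathVertex (swap₀ b0 c) a wv s le) ≡ x (pathVertex c a wv s le)
        cases c = casesAux c (c F.≟ zero) (c F.≟ b0)
          where
          casesAux : ∀ c → Dec (c ≡ zero) → Dec (c ≡ b0) → x (pathVertex (swap₀ b0 c) a wv s le) ≡ x (pathVertex c a wv s le)
          casesAux c (yes refl) _ = value-b₀≡value-0 a wv s le
          casesAux c (no c≢0) (yes refl) = trans (cong (λ v → x (pathVertex v a wv s le)) (swap₀-target b0)) (sym (value-b₀≡value-0 a wv s le))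
          casesAux c (no c≢0) (no c≢b) = cong (λ v → x (pathVertex v a wv s le)) (swap₀-other b0 c c≢0 c≢b)
    q' : ∀ (b' : Fin (suc e)) → toℕ b' ℕ.< suc β → Invariant (swapAt r (suc b')) x
    q' b' lt with ℕP.m≤n⇒m<n∨m≡n (ℕP.≤-pred lt)
    ... | inj₁ lt' = q b' lt'
    ... | inj₂ eq rewrite toℕ-injective {i = b'} {j = b0'} eq = invariant-b₀

  L∩A'⊆L' : ∀ x → LevelStage r (suc β) x → ΔImage (LevelStage r β) x → ΔImage (LevelStage r (suc β)) x
  L∩A'⊆L' x (p , q) (c , (pc , qc) , ex) = c , (pc , qc') , ex
    where
    qc' : ∀ (b' : Fin (suc e)) → toℕ b' ℕ.< suc β → Invariant (swapAt r (suc b')) c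
    qc' b' lt with ℕP.m≤n⇒m<n∨m≡n (ℕP.≤-pred lt)
    ... | inj₁ lt' = qc b' lt'
    ... | inj₂ eq rewrite toℕ-injective {i = b'} {j = b0'} eq =
      Invariant-Δ⁻¹ (swapAt r b0) (Δ-swapAt r b0) c (λ u → trans (sym (ex (swapAt r b0 u))) (trans (q b0' ℕP.≤-refl u) (ex u)))

  L'⊆L : ∀ x → ΔImage (LevelStage r (suc β)) x → ΔImage (LevelStage r β) x
  L'⊆L x (c , ac , ex) = c , A'⊆A c ac , ex

  open Extension (LevelStage r β) (ΔImage (LevelStage r β)) (LevelStage r (suc β)) (ΔImage (LevelStage r (suc β))) B LB
    (LevelStage-subgroup r β) (ΔImage-subgroup (LevelStage r β) (LevelStage-subgroup r β)) (LevelStage-subgroup r (suc β))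
    (Fibrewise-subgroup {Fin d} (Fibrewise-subgroup {Vec (Fin m) r} Supported-subgroup)) (Fibrewise-subgroup {Fin d} (Fibrewise-subgroup {Vec (Fin m) r} PathImage-subgroup))
    π σ π-add π-sub π∈B (λ y _ → σ∈A y) πσ π∈LB lift A'⊆A π-A' ker⊆A' L∩A'⊆L' L'⊆L

  Nlevel : ℕ
  Nlevel = (Npath ^ (m ^ r)) ^ d

  imageQuotientOrder : QuotientOrder B LB Nlevel
  imageQuotientOrder = fibrewise-Fin (Fibrewise {Vec (Fin m) r} Supported) (Fibrewise {Vec (Fin m) r} PathImage) d
      (fibrewise-Vec Supported PathImage Supported-subgroup PathImage-subgroup m r (pathQuotientOrder branchDet))

  levelStep : ∀ {N2} → QuotientOrder (LevelStage r (suc β)) (ΔImage (LevelStage r (suc β))) N2 → QuotientOrder (LevelStage r β) (ΔImage (LevelStage r β)) (Nlevel ℕ.* N2)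
  levelStep h2 = extension imageQuotientOrder h2

module RootStages (e h' : ℕ) where
  open Tree e h'
  open MaximumPrinciple e h'
  open Swaps e h'
  open Invariance e h'

  RootStage : ℕ → (VV → ℤ) → Set
  RootStage γ x = InvariantFrom 0 x × (∀ (b' : Fin m) → toℕ b' ℕ.< γ → Invariant (swapBranch (suc b')) x)

  RootStage-subgroup : ∀ γ → IsSubgroup (RootStage γ)
  RootStage-subgroup γ =
    ×-subgroup (InvariantFrom-subgroup 0) (Π-subgroup λ b' → Π-subgroup λ _ → Invariant-subgroup (swapBranch (suc b')))

  RootStage-Δ : ∀ γ c → RootStage γ c → RootStage γ (Δ c)
  RootStage-Δ γ c (p , q) = InvariantFrom-Δ 0 c p , (λ b' lt → Invariant-Δ (swapBranch (suc b')) (Δ-swapBranch (suc b')) c (q b' lt))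

module RootStep (e h' : ℕ) (b0' : Fin (suc (suc e))) where
  open Tree e h'
  open MaximumPrinciple e h'
  open Swaps e h'
  open Invariance e h'
  open RootStages e h'

  γ : ℕ
  γ = toℕ b0'
  b0 : Fin d
  b0 = suc b0'
  t : ℕ
  t = h'

  Npath : ℕ
  Npath = repunit m (suc (suc t))
  open BranchDet m t using (nzN; branchDet)
  open PathLattice (+ d) (+ m) (+ m) t Npath

  pathVertex : Fin d → (s : ℕ) → .(s ℕ.≤ t) → VV
  pathVertex cc s le = node s (s≤s le) cc (zeros s)

  column : (VV → ℤ) → Fin d → ℕ → ℤ
  column x cc = restrict t (λ s le → x (pathVertex cc s le))

  open RestrictedDifference (pathVertex b0) (pathVertex zero) renaming (diff to πv; diff-resp to π-resp; diff-+ to π-add; diff-- to π-sub)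

  πv-yes : ∀ x s (le : s ℕ.≤ t) → πv x s ≡ x (pathVertex b0 s le) - x (pathVertex zero s le)
  πv-yes x = restrict-≤ _

  πv-column : ∀ x s → πv x s ≡ column x b0 s - column x zero s
  πv-column x = restrict-zip _-_ refl _ _

  module _ (c : VV → ℤ) (pc : InvariantFrom 0 c) where
    sum-children-column : ∀ cc s (le : s ℕ.≤ t) → sumℤ (map c (children (pathVertex cc s le))) ≡ + m * column c cc (suc s)
    sum-children-column cc s le with suc s ℕ.<? h | suc s ℕ.≤? t
    ... | yes q | yes le' = trans (sum-map-map (allFin m) (λ c' → node (suc s) q cc (c' ∷ zeros s)) c)
        (trans (sum-map-cong (allFin m) (λ c' → radial c pc (suc s) q cc (c' ∷ zeros s) (zeros (suc s))))
          (ΣF-const m (c (pathVertex cc (suc s) le'))))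
    ... | yes (s≤s q) | no ¬le' = ⊥-elim (¬le' q)
    ... | no ¬q | yes le' = ⊥-elim (¬q (s≤s le'))
    ... | no _ | no _ = sym (ℤP.*-zeroʳ (+ m))

    π-Δ : ∀ s (le : s ℕ.≤ t) → πv (Δ c) s ≡ row (πv c) s
    π-Δ s le = begin
      πv (Δ c) s
        ≡⟨ πv-yes (Δ c) s le ⟩
      Δ c u₁ - Δ c u₀
        ≡⟨ cong₂ (λ x y → (+ d * c u₁ - c p₁ - x) - (+ d * c u₀ - c p₀ - y)) (sum-children-column b0 s le) (sum-children-column zero s le) ⟩
      (+ d * c u₁ - c p₁ - + m * n₁) - (+ d * c u₀ - c p₀ - + m * n₀)
        ≡⟨ difference-of-rows (+ d) (+ m) (c u₁) (c u₀) (c p₁) (c p₀) n₁ n₀ ⟩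
      + d * (c u₁ - c u₀) - (c p₁ - c p₀) - + m * (n₁ - n₀)
        ≡⟨ cong₃ (λ x y z → + d * x - y - z) (sym (πv-yes c s le)) (π-parent s le) (cong₂ _*_ (sym (wt≡ refl s)) (sym (πv-column c (suc s)))) ⟩
      row (πv c) s ∎
      where
      open ≡-Reasoning
      u₁ u₀ p₁ p₀ : VV
      u₁ = pathVertex b0 s le
      u₀ = pathVertex zero s le
      p₁ = parentN s (s≤s le) b0 (zeros s)
      p₀ = parentN s (s≤s le) zero (zeros s)
      n₁ n₀ : ℤ
      n₁ = column c b0 (suc s)
      n₀ = column c zero (suc s)
      π-parent : ∀ s (le : s ℕ.≤ t) → c (parentN s (s≤s le) b0 (zeros s)) - c (parentN s (s≤s le) zero (zeros s)) ≡ pre (πv c) s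
      π-parent zero le = ℤP.+-inverseʳ (c root)
      π-parent (suc s) le = sym (πv-yes c s (ℕP.<⇒≤ le))

  σ : (ℕ → ℤ) → VV → ℤ
  σ y root = + 0
  σ y (node k p a w) with a F.≟ b0
  ... | yes _ = y k
  ... | no _ = + 0

  σ-b0 : ∀ y k .p w → σ y (node k p b0 w) ≡ y k
  σ-b0 y k p w with b0 F.≟ b0
  ... | yes _ = refl
  ... | no ne = ⊥-elim (ne refl)

  σ-ne : ∀ y k .p a w → a ≢ b0 → σ y (node k p a w) ≡ + 0
  σ-ne y k p a w ne with a F.≟ b0
  ... | yes eq = ⊥-elim (ne eq)
  ... | no _ = refl

  σ-w : ∀ y k .p a w w' → σ y (node k p a w) ≡ σ y (node k p a w')
  σ-w y k p a w w' with a F.≟ b0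
  ... | yes _ = refl
  ... | no _ = refl

  πσ : ∀ y → Supported y → πv (σ y) ≈ y
  πσ y sy s with s ℕ.≤? t
  ... | yes le = trans (cong₂ _-_ (σ-b0 y s (s≤s le) (zeros s)) (σ-ne y s (s≤s le) zero (zeros s) (λ ()))) (ℤP.+-identityʳ (y s))
  ... | no ¬le = sym (sy s (ℕP.≰⇒> ¬le))

  σ∈A : ∀ y → RootStage γ (σ y)
  σ∈A y = (λ j b le → λ { root → refl ; (node k p a w) → σ-w y k p a (swapDigit j b w) w }) , inv
    where
    inv : ∀ (b' : Fin m) → toℕ b' ℕ.< γ → Invariant (swapBranch (suc b')) (σ y)
    inv b' lt root = refl
    inv b' lt (node k p a w) = aux a (a F.≟ zero) (a F.≟ suc b')
      where
      ne : suc b' ≢ b0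
      ne eq = ℕP.<-irrefl (cong toℕ (suc-injective eq)) lt
      aux : ∀ a → Dec (a ≡ zero) → Dec (a ≡ suc b') → σ y (node k p (swap₀ (suc b') a) w) ≡ σ y (node k p a w)
      aux a (yes refl) _ = trans (σ-ne y k p (suc b') w ne) (sym (σ-ne y k p zero w (λ ())))
      aux a (no a≢0) (yes refl) = trans (cong (λ v → σ y (node k p v w)) (swap₀-target (suc b'))) (trans (σ-ne y k p zero w (λ ())) (sym (σ-ne y k p (suc b') w ne)))
      aux a (no a≢0) (no a≢b) = cong (λ v → σ y (node k p v w)) (swap₀-other (suc b') a a≢0 a≢b)

  π∈B : ∀ x → RootStage γ x → Supported (πv x)
  π∈B x _ s lt = restrict-> _ s lt

  π∈LB : ∀ x → RootStage γ x → ΔImage (RootStage γ) x → PathImage (πv x)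
  π∈LB x _ (c , ac , ex) = πv c , (λ s lt → restrict-> _ s lt) ,
    (λ s le → trans (π-resp ex s) (π-Δ c (proj₁ ac) s le))

  lift : ∀ y → Supported y → PathImage y → ∃ λ ℓ → RootStage γ ℓ × ΔImage (RootStage γ) ℓ × πv ℓ ≈ y
  lift y sy (z , zs , zr) = Δ c , RootStage-Δ γ c (σ∈A z) , (c , σ∈A z , λ j → refl) , eqπ
    where
    c = σ z
    eqπ : πv (Δ c) ≈ y
    eqπ s with s ℕ.≤? t
    ... | no ¬le = sym (sy s (ℕP.≰⇒> ¬le))
    ... | yes le = trans (sym (πv-yes (Δ c) s le)) (trans (π-Δ c (proj₁ (σ∈A z)) s le)
        (trans (row-cong (πσ z zs) s) (sym (zr s le))))

  A'⊆A : ∀ x → RootStage (suc γ) x → RootStage γ x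
  A'⊆A x (p , q) = p , (λ b' lt → q b' (ℕP.m<n⇒m<1+n lt))

  π-A' : ∀ x → RootStage (suc γ) x → πv x ≈ 𝟘
  π-A' x (p , q) s with s ℕ.≤? t
  ... | no _ = refl
  ... | yes le = trans (cong (λ u → u - x (pathVertex zero s le)) (q b0' ℕP.≤-refl (pathVertex zero s le))) (ℤP.+-inverseʳ (x (pathVertex zero s le)))

  ker⊆A' : ∀ x → RootStage γ x → πv x ≈ 𝟘 → RootStage (suc γ) x
  ker⊆A' x (px , q) πz = px , q'
    where
    value-b₀≡value-0 : ∀ s (le : s ℕ.≤ t) → x (pathVertex b0 s le) ≡ x (pathVertex zero s le)
    value-b₀≡value-0 s le = ℤP.i-j≡0⇒i≡j _ _ (trans (sym (πv-yes x s le)) (πz s))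
    invariant-b₀ : Invariant (swapBranch b0) x
    invariant-b₀ root = refl
    invariant-b₀ (node k p a w) = trans (radial x px k p (swap₀ b0 a) w (zeros k)) (trans (cases a (a F.≟ zero) (a F.≟ b0)) (radial x px k p a (zeros k) w))
      where
      le : k ℕ.≤ t
      le = ℕP.≤-pred (recompute (k ℕ.<? h) p)
      cases : ∀ a → Dec (a ≡ zero) → Dec (a ≡ b0) → x (node k p (swap₀ b0 a) (zeros k)) ≡ x (node k p a (zeros k))
      cases a (yes refl) _ = value-b₀≡value-0 k le
      cases a (no a≢0) (yes refl) = trans (cong (λ v → x (node k p v (zeros k))) (swap₀-target b0)) (sym (value-b₀≡value-0 k le))
      cases a (no a≢0) (no a≢b) = cong (λ v → x (node k p v (zeros k))) (swap₀-other b0 a a≢0 a≢b)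
    q' : ∀ (b' : Fin m) → toℕ b' ℕ.< suc γ → Invariant (swapBranch (suc b')) x
    q' b' lt with ℕP.m≤n⇒m<n∨m≡n (ℕP.≤-pred lt)
    ... | inj₁ lt' = q b' lt'
    ... | inj₂ eq rewrite toℕ-injective {i = b'} {j = b0'} eq = invariant-b₀

  L∩A'⊆L' : ∀ x → RootStage (suc γ) x → ΔImage (RootStage γ) x → ΔImage (RootStage (suc γ)) x
  L∩A'⊆L' x (p , q) (c , (pc , qc) , ex) = c , (pc , qc') , ex
    where
    qc' : ∀ (b' : Fin m) → toℕ b' ℕ.< suc γ → Invariant (swapBranch (suc b')) c
    qc' b' lt with ℕP.m≤n⇒m<n∨m≡n (ℕP.≤-pred lt)
    ... | inj₁ lt' = qc b' lt'
    ... | inj₂ eq rewrite toℕ-injective {i = b'} {j = b0'} eq =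
      Invariant-Δ⁻¹ (swapBranch b0) (Δ-swapBranch b0) c (λ u → trans (sym (ex (swapBranch b0 u))) (trans (q b0' ℕP.≤-refl u) (ex u)))

  L'⊆L : ∀ x → ΔImage (RootStage (suc γ)) x → ΔImage (RootStage γ) x
  L'⊆L x (c , ac , ex) = c , A'⊆A c ac , ex

  open Extension (RootStage γ) (ΔImage (RootStage γ)) (RootStage (suc γ)) (ΔImage (RootStage (suc γ))) Supported PathImage
    (RootStage-subgroup γ) (ΔImage-subgroup (RootStage γ) (RootStage-subgroup γ)) (RootStage-subgroup (suc γ)) Supported-subgroup PathImage-subgroup
    πv σ π-add π-sub π∈B (λ y _ → σ∈A y) πσ π∈LB lift A'⊆A π-A' ker⊆A' L∩A'⊆L' L'⊆L

  rootStep : ∀ {N2} → QuotientOrder (RootStage (suc γ)) (ΔImage (RootStage (suc γ))) N2 → QuotientOrder (RootStage γ) (ΔImage (RootStage γ)) (Npath ℕ.* N2)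
  rootStep h2 = extension (pathQuotientOrder branchDet) h2

module RadialStage (e h' : ℕ) where
  open Tree e h'
  open MaximumPrinciple e h'
  open Swaps e h'
  open Invariance e h'
  open RootStages e h'

  Radial : (VV → ℤ) → Set
  Radial = RootStage m

  Radial-swapBranch : ∀ x → Radial x → ∀ (a : Fin d) → Invariant (swapBranch a) x
  Radial-swapBranch x (p , q) zero u = cong x (swapBranch-zero u)
  Radial-swapBranch x (p , q) (suc b') = q b' (toℕ<n b')

  t : ℕ
  t = suc h'

  instance
    nzm : ℕ.NonZero m
    nzm = _
  open RadialDet m t using (N; nzN; radialDet)
  open PathLattice (+ d) (+ m) (+ d) t N

  radialVertex : (s : ℕ) → .(s ℕ.≤ t) → VV
  radialVertex zero _ = root
  radialVertex (suc s) le = node s le zero (zeros s)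

  πv : (VV → ℤ) → ℕ → ℤ
  πv x = restrict t (λ s le → x (radialVertex s le))

  πv-yes : ∀ x s (le : s ℕ.≤ t) → πv x s ≡ x (radialVertex s le)
  πv-yes x = restrict-≤ _

  radial-value : ∀ x → Radial x → ∀ k .p a w → x (node k p a w) ≡ x (node k p zero (zeros k))
  radial-value x ax k p a w = trans (radial x (proj₁ ax) k p a w (zeros k)) (Radial-swapBranch x ax a (node k p zero (zeros k)))

  module _ (c : VV → ℤ) (ac : Radial c) where
    sum-children-column : ∀ s (le : suc s ℕ.≤ t) → sumℤ (map c (children (radialVertex (suc s) le))) ≡ + m * πv c (suc (suc s))
    sum-children-column s le with suc s ℕ.<? h | suc (suc s) ℕ.≤? t
    ... | yes q | yes le' = trans (sum-map-map (allFin m) (λ c' → node (suc s) q zero (c' ∷ zeros s)) c)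
        (trans (sum-map-cong (allFin m) (λ c' → radial c (proj₁ ac) (suc s) q zero (c' ∷ zeros s) (zeros (suc s))))
          (ΣF-const m (c (radialVertex (suc (suc s)) le'))))
    ... | yes q | no ¬le' = ⊥-elim (¬le' q)
    ... | no ¬q | yes le' = ⊥-elim (¬q le')
    ... | no _ | no _ = sym (ℤP.*-zeroʳ (+ m))

    sum-root-children : sumℤ (map c (children root)) ≡ + d * c (radialVertex 1 (s≤s z≤n))
    sum-root-children with 0 ℕ.<? h
    ... | no ¬q = ⊥-elim (¬q (s≤s z≤n))
    ... | yes q = trans (sum-map-map (allFin d) (λ a → node 0 q a []) c) (trans (sum-map-cong (allFin d) (λ a → radial-value c ac 0 q a [])) (ΣF-const d (c (radialVertex 1 (s≤s z≤n)))))

    π-Δ : ∀ s (le : s ℕ.≤ t) → πv (Δ c) s ≡ row (πv c) s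
    π-Δ zero le = trans (πv-yes (Δ c) 0 le) (trans (cong (λ u → + d * c root - u) sum-root-children)
      (trans (regroup (+ d) (c root) (c (radialVertex 1 (s≤s z≤n)))) (cong₂ (λ u v → + d * u - + 0 - + d * v) (sym (πv-yes c 0 le)) (sym (πv-yes c 1 (s≤s z≤n))))))
      where
      regroup : ∀ D a b → D * a - D * b ≡ D * a - + 0 - D * b
      regroup = solve-∀
    π-Δ (suc s) le = trans (πv-yes (Δ c) (suc s) le) (trans (cong (λ u → + d * c (radialVertex (suc s) le) - c (parentN s le zero (zeros s)) - u) (sum-children-column s le))
      (cong₃ (λ u v w' → + d * u - v - + m * w') (sym (πv-yes c (suc s) le)) (π-parent s le) refl))
      where
      π-parent : ∀ s (le : suc s ℕ.≤ t) → c (parentN s le zero (zeros s)) ≡ πv c s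
      π-parent zero le = sym (πv-yes c 0 z≤n)
      π-parent (suc s) le = sym (πv-yes c (suc s) (ℕP.<⇒≤ le))

  σ : (ℕ → ℤ) → VV → ℤ
  σ y root = y 0
  σ y (node k p a w) = y (suc k)

  σ∈A : ∀ y → Radial (σ y)
  σ∈A y = (λ j b le → λ { root → refl ; (node k p a w) → refl }) , (λ b' lt → λ { root → refl ; (node k p a w) → refl })

  πσ : ∀ y → Supported y → πv (σ y) ≈ y
  πσ y sy s with s ℕ.≤? t
  ... | yes le = lem s le
    where
    lem : ∀ s le → σ y (radialVertex s le) ≡ y s
    lem zero le = refl
    lem (suc s) le = refl
  ... | no ¬le = sym (sy s (ℕP.≰⇒> ¬le))

  π-resp : ∀ {x y} → x ≈ y → πv x ≈ πv y
  π-resp eq = restrict-cong (λ s le → eq (radialVertex s le))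

  π-add : ∀ x y → πv (x +ᵥ y) ≈ πv x +ᵥ πv y
  π-add x y = restrict-zip _+_ refl _ _

  π-sub : ∀ x y → πv (x -ᵥ y) ≈ πv x -ᵥ πv y
  π-sub x y = restrict-zip _-_ refl _ _

  π∈B : ∀ x → Radial x → Supported (πv x)
  π∈B x _ s lt = restrict-> _ s lt

  π∈LB : ∀ x → Radial x → ΔImage Radial x → PathImage (πv x)
  π∈LB x _ (c , ac , ex) = πv c , (λ s lt → restrict-> _ s lt) ,
    (λ s le → trans (π-resp ex s) (π-Δ c ac s le))

  lift : ∀ y → Supported y → PathImage y → ∃ λ ℓ → Radial ℓ × ΔImage Radial ℓ × πv ℓ ≈ y
  lift y sy (z , zs , zr) = Δ c , RootStage-Δ m c (σ∈A z) , (c , σ∈A z , λ j → refl) , eqπ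
    where
    c = σ z
    eqπ : πv (Δ c) ≈ y
    eqπ s with s ℕ.≤? t
    ... | no ¬le = sym (sy s (ℕP.≰⇒> ¬le))
    ... | yes le = trans (sym (πv-yes (Δ c) s le)) (trans (π-Δ c (σ∈A z) s le)
        (trans (row-cong (πσ z zs) s) (sym (zr s le))))

  Zero : (VV → ℤ) → Set
  Zero x = x ≈ 𝟘

  Zero-subgroup : IsSubgroup Zero
  Zero-subgroup = record
    { ∈-resp = λ eq p j → trans (sym (eq j)) (p j)
    ; 𝟘∈ = λ j → refl
    ; +∈ = λ p q j → cong₂ _+_ (p j) (q j)
    ; neg∈ = λ p j → cong -_ (p j) }

  A'⊆A : ∀ x → Zero x → Radial x
  A'⊆A x zx = IsSubgroup.∈-resp (RootStage-subgroup m) (λ j → sym (zx j)) (IsSubgroup.𝟘∈ (RootStage-subgroup m))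

  π-A' : ∀ x → Zero x → πv x ≈ 𝟘
  π-A' x zx s with s ℕ.≤? t
  ... | yes le = zx _
  ... | no _ = refl

  ker⊆A' : ∀ x → Radial x → πv x ≈ 𝟘 → Zero x
  ker⊆A' x ax πz root = trans (sym (πv-yes x 0 z≤n)) (πz 0)
  ker⊆A' x ax πz (node k p a w) = trans (radial-value x ax k p a w) (trans (sym (πv-yes x (suc k) (recompute (k ℕ.<? h) p))) (πz (suc k)))

  L∩A'⊆L' : ∀ x → Zero x → ΔImage Radial x → Zero x
  L∩A'⊆L' x zx _ = zx

  L'⊆L : ∀ x → Zero x → ΔImage Radial x
  L'⊆L x zx = 𝟘 , IsSubgroup.𝟘∈ (RootStage-subgroup m) , (λ j → trans (zx j) (sym (Δ-zero j)))

  open Extension Radial (ΔImage Radial) Zero Zero Supported PathImage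
    (RootStage-subgroup m) (ΔImage-subgroup Radial (RootStage-subgroup m)) Zero-subgroup Supported-subgroup PathImage-subgroup
    πv σ π-add π-sub π∈B (λ y _ → σ∈A y) πσ π∈LB lift A'⊆A π-A' ker⊆A' L∩A'⊆L' L'⊆L

  trivialQuotientOrder : QuotientOrder Zero Zero 1
  trivialQuotientOrder = (λ _ → 𝟘) , (λ _ j → refl) , (λ x zx → zero , (λ j → trans (cong (_- + 0) (zx j)) refl)) , (λ { zero zero _ → refl })

  radialQuotientOrder : QuotientOrder Radial (ΔImage Radial) (N ℕ.* 1)
  radialQuotientOrder = extension (pathQuotientOrder radialDet) trivialQuotientOrder

powMul : ℕ → ℕ → ℕ → ℕ
powMul a zero N = N
powMul a (suc n) N = a ℕ.* powMul a n N

iterate-steps : (Q : ℕ → ℕ → Set) (a n : ℕ) → (∀ β → β ℕ.< n → ∀ {N} → Q (suc β) N → Q β (a ℕ.* N)) →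
  ∀ {N} → Q n N → Q 0 (powMul a n N)
iterate-steps Q a n step {N} qn = go n 0 refl
  where
  go : ∀ k β → β ℕ.+ k ≡ n → Q β (powMul a k N)
  go zero β β+0≡n = subst (λ b → Q b N) (sym (trans (sym (ℕP.+-identityʳ β)) β+0≡n)) qn
  go (suc k) β β+k≡n = step β (subst (β ℕ.<_) β+k≡n (ℕP.m<m+n β (s≤s z≤n))) (go k (suc β) (trans (sym (ℕP.+-suc β k)) β+k≡n))

module Assembly (e h' : ℕ) where
  open Tree e h'
  open MaximumPrinciple e h'
  open Swaps e h'
  open Invariance e h'
  open LevelStages e h'
  open RootStages e h'

  Nlevel : ℕ → ℕ
  Nlevel r = (repunit m (suc (suc (h' ℕ.∸ suc r))) ^ (m ^ r)) ^ d

  Nbranch : ℕ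
  Nbranch = repunit m (suc (suc h'))

  Nradial : ℕ
  Nradial = d ℕ.* m ^ suc h'

  ΔImage-⊆ : ∀ {A A' : (VV → ℤ) → Set} → (∀ x → A x → A' x) → ∀ x → ΔImage A x → ΔImage A' x
  ΔImage-⊆ A⊆A' x (c , c∈A , x≈Δc) = c , A⊆A' c c∈A , x≈Δc

  QuotientOrder-ΔImage-⇔ : ∀ {A A' : (VV → ℤ) → Set} {N} → (∀ x → A x → A' x) → (∀ x → A' x → A x) →
    QuotientOrder A (ΔImage A) N → QuotientOrder A' (ΔImage A') N
  QuotientOrder-ΔImage-⇔ A⊆A' A'⊆A = QuotientOrder-⇔ A⊆A' A'⊆A (ΔImage-⊆ A⊆A') (ΔImage-⊆ A'⊆A)

  LevelStage-all⇒InvariantFrom : ∀ r x → LevelStage r (suc e) x → InvariantFrom r x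
  LevelStage-all⇒InvariantFrom r x (p , q) j b r≤j with ℕP.m≤n⇒m<n∨m≡n r≤j
  ... | inj₁ r<j = p j b r<j
  ... | inj₂ refl with b
  ...   | zero = λ u → cong x (swapAt-zero r u)
  ...   | suc b' = q b' (toℕ<n b')

  InvariantFrom⇒LevelStage-all : ∀ r x → InvariantFrom r x → LevelStage r (suc e) x
  InvariantFrom⇒LevelStage-all r x p = (λ j b r<j → p j b (ℕP.<⇒≤ r<j)) , (λ b' _ → p r (suc b') ℕP.≤-refl)

  levelSteps : ∀ r → suc r ℕ.≤ h' → ∀ {N} → QuotientOrder (InvariantFrom r) (ΔImage (InvariantFrom r)) N →
    QuotientOrder (InvariantFrom (suc r)) (ΔImage (InvariantFrom (suc r))) (powMul (Nlevel r) (suc e) N)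
  levelSteps r r<h' q = QuotientOrder-ΔImage-⇔ (λ _ → proj₁) (λ _ p → p , λ _ ())
    (iterate-steps (λ β → QuotientOrder (LevelStage r β) (ΔImage (LevelStage r β))) (Nlevel r) (suc e) step
      (QuotientOrder-ΔImage-⇔ (InvariantFrom⇒LevelStage-all r) (LevelStage-all⇒InvariantFrom r) q))
    where
    step : ∀ β → β ℕ.< suc e → ∀ {N} → QuotientOrder (LevelStage r (suc β)) (ΔImage (LevelStage r (suc β))) N →
      QuotientOrder (LevelStage r β) (ΔImage (LevelStage r β)) (Nlevel r ℕ.* N)
    step β β<1+e {N} = subst (λ b → QuotientOrder (LevelStage r (suc b)) (ΔImage (LevelStage r (suc b))) N →
                                     QuotientOrder (LevelStage r b) (ΔImage (LevelStage r b)) (Nlevel r ℕ.* N))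
                             (toℕ-fromℕ< β<1+e) (LevelStep.levelStep e h' r r<h' (fromℕ< β<1+e))

  rootSteps : ∀ {N} → QuotientOrder (RootStage m) (ΔImage (RootStage m)) N →
    QuotientOrder (InvariantFrom 0) (ΔImage (InvariantFrom 0)) (powMul Nbranch m N)
  rootSteps q = QuotientOrder-ΔImage-⇔ (λ _ → proj₁) (λ _ p → p , λ _ ())
    (iterate-steps (λ γ → QuotientOrder (RootStage γ) (ΔImage (RootStage γ))) Nbranch m step q)
    where
    step : ∀ γ → γ ℕ.< m → ∀ {N} → QuotientOrder (RootStage (suc γ)) (ΔImage (RootStage (suc γ))) N →
      QuotientOrder (RootStage γ) (ΔImage (RootStage γ)) (Nbranch ℕ.* N)
    step γ γ<m {N} = subst (λ b → QuotientOrder (RootStage (suc b)) (ΔImage (RootStage (suc b))) N →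
                                  QuotientOrder (RootStage b) (ΔImage (RootStage b)) (Nbranch ℕ.* N))
                           (toℕ-fromℕ< γ<m) (RootStep.rootStep e h' (fromℕ< γ<m))

  stageOrder : ℕ → ℕ
  stageOrder zero = powMul Nbranch m (Nradial ℕ.* 1)
  stageOrder (suc r) = powMul (Nlevel r) (suc e) (stageOrder r)

  stageQuotientOrder : ∀ ρ → ρ ℕ.≤ h' → QuotientOrder (InvariantFrom ρ) (ΔImage (InvariantFrom ρ)) (stageOrder ρ)
  stageQuotientOrder zero _ = rootSteps (RadialStage.radialQuotientOrder e h')
  stageQuotientOrder (suc r) r<h' = levelSteps r r<h' (stageQuotientOrder r (ℕP.<⇒≤ r<h'))

  InvariantFrom-top : ∀ x → InvariantFrom h' x
  InvariantFrom-top x j b le root = refl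
  InvariantFrom-top x j b le (node k p a w) = cong (λ v → x (node k p a v)) (swapDigit-short j b w (ℕP.≤-trans (ℕP.≤-pred (recompute (k ℕ.<? h) p)) le))

  InL⇒ΔImage : ∀ x → InL d h x → ΔImage (InvariantFrom h') x
  InL⇒ΔImage x (c , x≈) = c , InvariantFrom-top c , λ j → trans (x≈ j) (δ-span≡Δ c j)

  ΔImage⇒InL : ∀ x → ΔImage (InvariantFrom h') x → InL d h x
  ΔImage⇒InL x (c , _ , x≈Δc) = c , λ j → trans (x≈Δc j) (sym (δ-span≡Δ c j))

  hasOrder-stageOrder : HasOrder d h (stageOrder h')
  hasOrder-stageOrder =
    let (r , _ , cover , unique) = stageQuotientOrder h' ℕP.≤-refl in
    r , (λ x → let (k , p) = cover x (InvariantFrom-top x) in k , ΔImage⇒InL _ p) , (λ k l p → unique k l (InL⇒ΔImage _ p))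

prodUpTo : (ℕ → ℕ) → ℕ → ℕ
prodUpTo f n = product (map f (upTo n))

prodUpTo-suc : ∀ f n → prodUpTo f (suc n) ≡ prodUpTo f n ℕ.* f n
prodUpTo-suc f n = begin
    product (map f (upTo (suc n))) ≡⟨ cong (λ l → product (map f l)) (sym (LP.applyUpTo-∷ʳ id n)) ⟩
    product (map f (upTo n ∷ʳ n)) ≡⟨ cong product (LP.map-++ f (upTo n) (n ∷ [])) ⟩
    product (map f (upTo n) List.++ (f n ∷ [])) ≡⟨ product-++ (map f (upTo n)) (f n ∷ []) ⟩
    prodUpTo f n ℕ.* (f n ℕ.* 1) ≡⟨ cong (prodUpTo f n ℕ.*_) (ℕP.*-identityʳ (f n)) ⟩
    prodUpTo f n ℕ.* f n ∎
  where open ≡-Reasoning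

prodUpTo-cong : ∀ f g n → (∀ r → r ℕ.< n → f r ≡ g r) → prodUpTo f n ≡ prodUpTo g n
prodUpTo-cong f g zero _ = refl
prodUpTo-cong f g (suc n) eq = trans (prodUpTo-suc f n) (trans (cong₂ ℕ._*_ (prodUpTo-cong f g n (λ r lt → eq r (ℕP.m<n⇒m<1+n lt))) (eq n ℕP.≤-refl)) (sym (prodUpTo-suc g n)))

powMul-eq : ∀ a n N → powMul a n N ≡ a ^ n ℕ.* N
powMul-eq a zero N = sym (ℕP.+-identityʳ N)
powMul-eq a (suc n) N = trans (cong (a ℕ.*_) (powMul-eq a n N)) (sym (ℕP.*-assoc a (a ^ n) N))

module Arithmetic (e h' : ℕ) where
  d m h : ℕ
  d = suc (suc (suc e))
  m = suc (suc e)
  h = suc h'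

  repunit-geometric : ∀ n → suc e ℕ.* repunit m n ℕ.+ 1 ≡ m ^ n
  repunit-geometric zero = cong (ℕ._+ 1) (ℕP.*-zeroʳ (suc e))
  repunit-geometric (suc n) = trans (hN e (repunit m n)) (cong (m ℕ.*_) (repunit-geometric n))
    where
    hN : ∀ e x → suc e ℕ.* suc (suc (suc e) ℕ.* x) ℕ.+ 1 ≡ suc (suc e) ℕ.* (suc e ℕ.* x ℕ.+ 1)
    hN = NS.solve-∀

  θ≡repunit : ∀ n → θ d n ≡ repunit m n
  θ≡repunit n = begin
      (m ^ n ℕ.∸ 1) / suc e ≡⟨ cong (λ u → (u ℕ.∸ 1) / suc e) (sym (repunit-geometric n)) ⟩
      (suc e ℕ.* repunit m n ℕ.+ 1 ℕ.∸ 1) / suc e ≡⟨ cong (_/ suc e) (ℕP.m+n∸n≡m (suc e ℕ.* repunit m n) 1) ⟩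
      (suc e ℕ.* repunit m n) / suc e ≡⟨ cong (_/ suc e) (ℕP.*-comm (suc e) (repunit m n)) ⟩
      (repunit m n ℕ.* suc e) / suc e ≡⟨ m*n/n≡m (repunit m n) (suc e) ⟩
      repunit m n ∎
    where open ≡-Reasoning

  open Assembly e h' using (stageOrder; Nlevel; Nbranch; Nradial)

  levelFactor : ℕ → ℕ
  levelFactor r = Nlevel r ^ suc e

  stageOrder≡ : ∀ ρ → stageOrder ρ ≡ prodUpTo levelFactor ρ ℕ.* (Nbranch ^ m ℕ.* Nradial)
  stageOrder≡ zero = trans (powMul-eq Nbranch m (Nradial ℕ.* 1)) (trans (cong (Nbranch ^ m ℕ.*_) (ℕP.*-identityʳ Nradial)) (sym (ℕP.+-identityʳ _)))
  stageOrder≡ (suc r) = trans (powMul-eq (Nlevel r) (suc e) (stageOrder r)) (trans (cong (levelFactor r ℕ.*_) (stageOrder≡ r))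
    (trans (hN (levelFactor r) (prodUpTo levelFactor r) (Nbranch ^ m ℕ.* Nradial)) (cong (ℕ._* (Nbranch ^ m ℕ.* Nradial)) (sym (prodUpTo-suc levelFactor r)))))
    where
    hN : ∀ a b c → a ℕ.* (b ℕ.* c) ≡ (b ℕ.* a) ℕ.* c
    hN = NS.solve-∀

  formulaFactor : ℕ → ℕ
  formulaFactor n = θ d (suc h ℕ.∸ n) ^ ((d ℕ.∸ 2) ℕ.* d ℕ.* (d ℕ.∸ 1) ^ (n ℕ.∸ 1))

  2+[k∸[1+r]]≡1+k∸r : ∀ r k → r ℕ.< k → suc (suc (k ℕ.∸ suc r)) ≡ suc k ℕ.∸ r
  2+[k∸[1+r]]≡1+k∸r zero (suc k) _ = refl
  2+[k∸[1+r]]≡1+k∸r (suc r) (suc k) (s≤s lt) = 2+[k∸[1+r]]≡1+k∸r r k lt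

  levelFactor≡formulaFactor : ∀ r → r ℕ.< h' → levelFactor r ≡ formulaFactor (suc r)
  levelFactor≡formulaFactor r lt = begin
      ((repunit m (suc (suc (h' ℕ.∸ suc r))) ^ (m ^ r)) ^ d) ^ suc e ≡⟨ cong (λ u → ((repunit m u ^ (m ^ r)) ^ d) ^ suc e) (2+[k∸[1+r]]≡1+k∸r r h' lt) ⟩
      ((repunit m (suc h' ℕ.∸ r) ^ (m ^ r)) ^ d) ^ suc e ≡⟨ cong (_^ suc e) (ℕP.^-*-assoc (repunit m (suc h' ℕ.∸ r)) (m ^ r) d) ⟩
      (repunit m (suc h' ℕ.∸ r) ^ (m ^ r ℕ.* d)) ^ suc e ≡⟨ ℕP.^-*-assoc (repunit m (suc h' ℕ.∸ r)) (m ^ r ℕ.* d) (suc e) ⟩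
      repunit m (suc h' ℕ.∸ r) ^ (m ^ r ℕ.* d ℕ.* suc e) ≡⟨ cong (repunit m (suc h' ℕ.∸ r) ^_) (hN (m ^ r) d (suc e)) ⟩
      repunit m (suc h' ℕ.∸ r) ^ (suc e ℕ.* d ℕ.* m ^ r) ≡⟨ cong (_^ (suc e ℕ.* d ℕ.* m ^ r)) (sym (θ≡repunit (suc h' ℕ.∸ r))) ⟩
      formulaFactor (suc r) ∎
    where
    open ≡-Reasoning
    hN : ∀ a b c → a ℕ.* b ℕ.* c ≡ c ℕ.* b ℕ.* a
    hN = NS.solve-∀

  stageOrder≡gFormula : stageOrder h' ≡ gFormula d h
  stageOrder≡gFormula = begin
      stageOrder h' ≡⟨ stageOrder≡ h' ⟩
      prodUpTo levelFactor h' ℕ.* (Nbranch ^ m ℕ.* Nradial) ≡⟨ cong (ℕ._* (Nbranch ^ m ℕ.* Nradial)) (prodUpTo-cong levelFactor (formulaFactor ∘ suc) h' levelFactor≡formulaFactor) ⟩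
      prodUpTo (formulaFactor ∘ suc) h' ℕ.* (Nbranch ^ m ℕ.* Nradial) ≡⟨ hN (prodUpTo (formulaFactor ∘ suc) h') (Nbranch ^ m) d (m ^ h) ⟩
      d ℕ.* m ^ h ℕ.* Nbranch ^ m ℕ.* prodUpTo (formulaFactor ∘ suc) h' ≡⟨ cong (λ u → d ℕ.* m ^ h ℕ.* u ^ m ℕ.* prodUpTo (formulaFactor ∘ suc) h') (sym (θ≡repunit (suc h))) ⟩
      d ℕ.* m ^ h ℕ.* θ d (suc h) ^ m ℕ.* prodUpTo (formulaFactor ∘ suc) h' ≡⟨ cong (λ u → d ℕ.* m ^ h ℕ.* θ d (suc h) ^ m ℕ.* product u) (LP.map-∘ {g = formulaFactor} {f = suc} (upTo h')) ⟩
      gFormula d h ∎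
    where
    open ≡-Reasoning
    hN : ∀ p q a b → p ℕ.* (q ℕ.* (a ℕ.* b)) ≡ a ℕ.* b ℕ.* q ℕ.* p
    hN = NS.solve-∀

theorem2p5 : (d h : ℕ) → 3 ≤ d → 1 ≤ h → HasOrder d h (gFormula d h)
theorem2p5 (suc (suc (suc e))) (suc h') _ _ =
  subst (HasOrder _ _) (Arithmetic.stageOrder≡gFormula e h') (Assembly.hasOrder-stageOrder e h')
theorem2p5 zero _ () _
theorem2p5 (suc zero) _ (s≤s ()) _
theorem2p5 (suc (suc zero)) _ (s≤s (s≤s ())) _
theorem2p5 (suc (suc (suc e))) zero _ ()
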